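{- Let $K_n$ be the complete graph on $n$ vertices and let $H$ be a finite simple connected graph with $m$ vertices. Then $$Sz(K_n\wr H)=n^3m^{3n-3}Sz(H)+\frac12 m^n n(n-1)\Big(m+m^{n-2}\big(m^2+mn-3m-n+2\big)\Big)^2.$$
   Context: The wreath product $G\wr H$ has vertex set $\{(f,v): f:V_G\to V_H,\ v\in V_G\}$; $(f,v)$ and $(f',v')$ are adjacent iff either $v=v'$, $f(w)=f'(w)$ for $w\neq v$ and $f(v)\sim f'(v)$ in $H$, or $f=f'$ and $v\sim v'$ in $G$. For a connected graph $X$ and edge $e=\{u,v\}$, $n_u(e)=|\{w\in V_X:d_X(w,u)<d_X(w,v)\}|$ ($d_X$ geodesic distance), and the Szeged index is $Sz(X)=\sum_{e=\{u,v\}\in E_X}n_u(e)n_v(e)$. Throughout, $n\ge2$. -}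

module Defs where

open import Data.Nat using (ℕ; zero; suc; _+_; _*_; _<ᵇ_)
open import Data.Bool using (Bool; true; false; _∧_; _∨_; not; T?)
open import Data.Fin using (Fin)
import Data.Fin.Properties as FinP
open import Data.List using (List; []; _∷_; _++_; map; concatMap; filterᵇ; takeWhileᵇ; length; upTo; allFin; cartesianProduct)
open import Data.Bool.ListAction using (any; all)
open import Data.Nat.ListAction using (sum)
open import Data.Vec using (Vec; lookup) renaming ([] to []ᵥ; _∷_ to _∷ᵥ_)
import Data.Vec.Properties as VecP
open import Data.Product using (_×_; _,_)
import Data.Product.Properties as ProdP
open import Relation.Binary.Definitions using (DecidableEquality)
open import Relation.Binary.PropositionalEquality using (_≡_)
open import Relation.Nullary using (does)

record Graph : Set₁ where
  field
    V     : Set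
    verts : List V
    _≟V_  : DecidableEquality V
    adj   : V → V → Bool

open Graph

Adj : ℕ → Set
Adj m = Fin m → Fin m → Bool

IsSimple : ∀ {m} → Adj m → Set
IsSimple {m} a = (∀ u v → a u v ≡ a v u) × (∀ u → a u u ≡ false)

data Walk {m : ℕ} (a : Adj m) : Fin m → Fin m → Set where
  here : ∀ {x} → Walk a x x
  step : ∀ {x y z} → a x y ≡ true → Walk a y z → Walk a x z

IsConnected : ∀ {m} → Adj m → Set
IsConnected {m} a = ∀ (u v : Fin m) → Walk a u v

finGraph : (m : ℕ) → Adj m → Graph
finGraph m a = record { V = Fin m ; verts = allFin m ; _≟V_ = FinP._≟_ ; adj = a }

completeAdj : (n : ℕ) → Adj n
completeAdj n u v = not (does (u FinP.≟ v))

-- Wreath product G ≀ H, G on Fin n, H on Fin m.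
-- Vertices (f , v) with f : V_G → V_H represented as a vector Vec (Fin m) n.

allVecs : (n m : ℕ) → List (Vec (Fin m) n)
allVecs zero    m = []ᵥ ∷ []
allVecs (suc n) m = concatMap (λ i → map (i ∷ᵥ_) (allVecs n m)) (allFin m)

wreath : (n m : ℕ) → Adj n → Adj m → Graph
wreath n m aG aH = record
  { V     = Vec (Fin m) n × Fin n
  ; verts = cartesianProduct (allVecs n m) (allFin n)
  ; _≟V_  = ProdP.≡-dec (VecP.≡-dec FinP._≟_) FinP._≟_
  ; adj   = λ { (f , v) (f' , v') →
              ( does (v FinP.≟ v')
                ∧ all (λ w → does (w FinP.≟ v) ∨ does (lookup f w FinP.≟ lookup f' w)) (allFin n)
                ∧ aH (lookup f v) (lookup f' v) )
              ∨ ( does (VecP.≡-dec FinP._≟_ f f') ∧ aG v v' ) }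
  }

module _ (X : Graph) where
  private
    N = length (verts X)
    _==_ : V X → V X → Bool
    x == y = does ((_≟V_ X) x y)

  reach : ℕ → V X → V X → Bool
  reach zero    x y = x == y
  reach (suc k) x y = reach k x y ∨ any (λ z → reach k x z ∧ adj X z y) (verts X)

  -- geodesic distance: least k with reach k x y (k < N suffices in a
  -- connected graph on N vertices); defaults to N if unreachable.
  dist : V X → V X → ℕ
  dist x y = length (takeWhileᵇ (λ k → not (reach k x y)) (upTo N))

  nVert : V X → V X → ℕ
  nVert u v = length (filterᵇ (λ w → dist w u <ᵇ dist w v) (verts X))

  -- each unordered edge {x , y} listed once (x before y in verts)
  edgesOf : List (V X) → List (V X × V X)
  edgesOf []       = []
  edgesOf (x ∷ xs) = map (x ,_) (filterᵇ (adj X x) xs) ++ edgesOf xs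

  Sz : ℕ
  Sz = sum (map (λ { (u , v) → nVert u v * nVert v u }) (edgesOf (verts X)))

-- Write a vertex of Kₙ ≀ H as (f , v). The distance from (g , x) to (f , v) is the sum
-- of d_H (g u) (f u) over all coordinates u, plus the length of a shortest walk in Kₙ
-- from x to v through every u ∉ {x , v} with g u ≠ f u: this function vanishes only at
-- (g , x), grows by at most one along edges and drops by one along some edge into every
-- other vertex, and these properties characterise breadth-first distance.
-- Summing over all sources (g , x): across an H-edge in coordinate v only d_H (g v) matters,
-- so n_u(e) is n m^(n-1) times the corresponding count in H; across a Kₙ-edge it is
-- m + (m-1) m^(n-1) + (n-2)(m-1) m^(n-2) for every edge. Summing n_u(e) n_v(e) over
-- ordered pairs of adjacent vertices counts every edge twice.

module Submission where

open import Defs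
open import Algebra.Bundles using (CommutativeMonoid)
open import Data.Bool using (Bool; true; false; _∧_; _∨_; not; if_then_else_)
open import Data.Bool.Properties using (∨-zeroʳ; ∧-zeroʳ; not-involutive)
open import Data.Bool.ListAction using (all; any)
open import Data.Fin using (Fin; zero; suc; punchIn; punchOut)
open import Data.Fin.Properties using (_≟_; punchInᵢ≢i; punchIn-injective; punchIn-punchOut)
import Data.List.Properties as ListP
open import Data.List using (List; []; _∷_; _++_; map; concatMap; filterᵇ; takeWhileᵇ; length; allFin; tabulate; applyUpTo; cartesianProduct)
open import Data.List.Membership.Propositional using (_∈_)
open import Data.List.Membership.Propositional.Properties using (∈-allFin; ∈-cartesianProduct⁺; ∈-concatMap⁺; ∈-map⁺)
import Data.List.Relation.Unary.Any as Any
open import Data.List.Relation.Unary.Any using (here; there)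
open import Data.Nat using (ℕ; zero; suc; +-0-rawMonoid; _+_; _*_; _∸_; _^_; _/_; _≤_; _<_; _<ᵇ_; _≤′_; ≤′-refl; ≤′-step; z≤n; s≤s)
open import Data.Nat.Properties hiding (_≟_)
open import Data.Product using (_×_; _,_; proj₁; proj₂; ∃)
open import Data.Sum using (_⊎_; inj₁; inj₂)
open import Data.Empty using (⊥-elim)
open import Data.Vec using (Vec; lookup; _[_]≔_) renaming ([] to []ᵥ; _∷_ to _∷ᵥ_)
open import Data.Vec.Functional using (Vector; removeAt)
open import Function using (_∘_; mk⇔)
open import Relation.Binary.PropositionalEquality
open import Relation.Nullary using (Dec; does; yes; no; ¬_)
open import Relation.Nullary.Decidable using (dec-true; dec-false; does-⇔)
import Data.Vec.Properties as VecP

open import Algebra.Properties.Semiring.Sum +-*-semiring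
  using (sum; sum-syntax; sum-cong-≗; sum-replicate-zero; sum-remove; ∑-distrib-+; *-distribˡ-sum; *-distribʳ-sum)
import Algebra.Definitions.RawMonoid as RawMonoid
import Data.Nat.ListAction as ListAction
open import Data.Nat.Tactic.RingSolver using (solve-∀)
open import Data.Nat.DivMod using (m*n/n≡m)
import Algebra.Properties.CommutativeMonoid.Sum as MonoidSum
open MonoidSum *-1-commutativeMonoid
  using () renaming (sum to product; sum-cong-≗ to product-cong-≗; ∑-distrib-+ to ∏-distrib-*)
open import Algebra.Properties.CommutativeSemigroup +-commutativeSemigroup using () renaming (interchange to +-interchange)

open Graph

⟦_⟧ : Bool → ℕ
⟦ true ⟧  = 1
⟦ false ⟧ = 0

⟦∧⟧ : ∀ a b → ⟦ a ∧ b ⟧ ≡ ⟦ a ⟧ * ⟦ b ⟧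
⟦∧⟧ true  b = sym (*-identityˡ ⟦ b ⟧)
⟦∧⟧ false b = refl

does-sym : ∀ {n} (x y : Fin n) → does (x ≟ y) ≡ does (y ≟ x)
does-sym x y = does-⇔ (mk⇔ sym sym) (x ≟ y) (y ≟ x)

⟦⟧≤1 : ∀ b → ⟦ b ⟧ ≤ 1
⟦⟧≤1 true  = ≤-refl
⟦⟧≤1 false = z≤n

⟦⟧-mono : ∀ {a b} → (a ≡ true → b ≡ true) → ⟦ a ⟧ ≤ ⟦ b ⟧
⟦⟧-mono {false} _    = z≤n
⟦⟧-mono {true}  a⇒b rewrite a⇒b refl = ≤-refl

true≢false : true ≢ false
true≢false ()

does⇒ : ∀ {A : Set} (a? : Dec A) → does a? ≡ true → A
does⇒ (yes a) _ = a

∨-true⁻ : ∀ {a b} → a ∨ b ≡ true → a ≡ true ⊎ b ≡ true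
∨-true⁻ {true}  _   = inj₁ refl
∨-true⁻ {false} b≡t = inj₂ b≡t

⟦⟧≢0⇒ : ∀ {b} → ⟦ b ⟧ ≢ 0 → b ≡ true
⟦⟧≢0⇒ {true}  _    = refl
⟦⟧≢0⇒ {false} ⟦b⟧≢0 = ⊥-elim (⟦b⟧≢0 refl)

not-does⇒ : ∀ {A : Set} (a? : Dec A) → not (does a?) ≡ true → ¬ A
not-does⇒ (no ¬a) _ = ¬a

∧-true⁻ : ∀ {a b} → a ∧ b ≡ true → a ≡ true × b ≡ true
∧-true⁻ {true} {true} _ = refl , refl

module _ {A : Set} (p : A → Bool) where

  any-true⁻ : ∀ xs → any p xs ≡ true → ∃ λ x → x ∈ xs × p x ≡ true
  any-true⁻ (x ∷ xs) any≡t with ∨-true⁻ {p x} any≡t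
  ... | inj₁ px≡t    = x , here refl , px≡t
  ... | inj₂ rest≡t  = let y , y∈xs , py≡t = any-true⁻ xs rest≡t in y , there y∈xs , py≡t

  any-true⁺ : ∀ {xs x} → x ∈ xs → p x ≡ true → any p xs ≡ true
  any-true⁺ (here refl) px≡t rewrite px≡t = refl
  any-true⁺ {y ∷ _} (there x∈xs) px≡t rewrite any-true⁺ x∈xs px≡t = ∨-zeroʳ (p y)

  all-true⁻ : ∀ xs → all p xs ≡ true → ∀ {x} → x ∈ xs → p x ≡ true
  all-true⁻ (y ∷ xs) all≡t (here refl)  = proj₁ (∧-true⁻ {p y} all≡t)
  all-true⁻ (y ∷ xs) all≡t (there x∈xs) = all-true⁻ xs (proj₂ (∧-true⁻ {p y} all≡t)) x∈xs

  all-true⁺ : ∀ xs → (∀ {x} → x ∈ xs → p x ≡ true) → all p xs ≡ true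
  all-true⁺ []       _   = refl
  all-true⁺ (y ∷ xs) p≡t rewrite p≡t (here refl) = all-true⁺ xs (p≡t ∘ there)

all-cong : ∀ {A : Set} {p q : A → Bool} xs → (∀ x → p x ≡ q x) → all p xs ≡ all q xs
all-cong []       p≗q = refl
all-cong (x ∷ xs) p≗q = cong₂ _∧_ (p≗q x) (all-cong xs p≗q)

does-≡ : ∀ {A : Set} (a? : Dec A) {b} → (A → b ≡ true) → (b ≡ true → A) → does a? ≡ b
does-≡ (yes a) {true}  _  _    = refl
does-≡ (yes a) {false} to _    = sym (to a)
does-≡ (no ¬a) {true}  _  from = ⊥-elim (¬a (from refl))
does-≡ (no _)  {false} _  _    = refl

<ᵇ-cancelˡ : ∀ c a b → (c + a <ᵇ c + b) ≡ (a <ᵇ b)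
<ᵇ-cancelˡ c a b = does-⇔ (mk⇔ (+-cancelˡ-< c a b) (+-monoʳ-< c)) (c + a <? c + b) (a <? b)

<ᵇ-cancelʳ : ∀ c a b → (a + c <ᵇ b + c) ≡ (a <ᵇ b)
<ᵇ-cancelʳ c a b = does-⇔ (mk⇔ (+-cancelʳ-< c a b) (+-monoˡ-< c)) (a + c <? b + c) (a <? b)

<ᵇ-exchange : ∀ {a a' b b'} → a + b' ≡ a' + b → (a <ᵇ a') ≡ (b <ᵇ b')
<ᵇ-exchange {a} {a'} {b} {b'} e = does-⇔ (mk⇔ (exchange e) (exchange e')) (a <? a') (b <? b')
  where
  exchange : ∀ {a a' b b'} → a + b' ≡ a' + b → a < a' → b < b'
  exchange {a} {a'} {b} {b'} e a<a' = +-cancelˡ-< a' b b' (subst (_< a' + b') e (+-monoˡ-< b' a<a'))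
  e' : b + a' ≡ b' + a
  e' = trans (+-comm b a') (trans (sym e) (+-comm a b'))

∑-list : {A : Set} → List A → (A → ℕ) → ℕ
∑-list []       f = 0
∑-list (x ∷ xs) f = f x + ∑-list xs f

infixl 10 ∑-list
syntax ∑-list xs (λ x → e) = ∑[ x ∈ xs ] e

module _ {A : Set} where

  ∑-list-cong : ∀ (xs : List A) {f g : A → ℕ} → (∀ x → f x ≡ g x) → ∑-list xs f ≡ ∑-list xs g
  ∑-list-cong []       f≗g = refl
  ∑-list-cong (x ∷ xs) f≗g = cong₂ _+_ (f≗g x) (∑-list-cong xs f≗g)

  ∑-list-++ : ∀ (xs ys : List A) f → ∑-list (xs ++ ys) f ≡ ∑-list xs f + ∑-list ys f
  ∑-list-++ []       ys f = refl
  ∑-list-++ (x ∷ xs) ys f = trans (cong (f x +_) (∑-list-++ xs ys f)) (sym (+-assoc (f x) _ _))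

  ∑-list-distrib-+ : ∀ (xs : List A) f g → ∑[ x ∈ xs ] (f x + g x) ≡ ∑-list xs f + ∑-list xs g
  ∑-list-distrib-+ []       f g = refl
  ∑-list-distrib-+ (x ∷ xs) f g = trans (cong (f x + g x +_) (∑-list-distrib-+ xs f g)) (+-interchange (f x) (g x) _ _)

  *-distribˡ-∑-list : ∀ (xs : List A) c f → c * ∑-list xs f ≡ ∑[ x ∈ xs ] (c * f x)
  *-distribˡ-∑-list []       c f = *-zeroʳ c
  *-distribˡ-∑-list (x ∷ xs) c f = trans (*-distribˡ-+ c (f x) _) (cong (c * f x +_) (*-distribˡ-∑-list xs c f))

  *-distribʳ-∑-list : ∀ (xs : List A) c f → ∑-list xs f * c ≡ ∑[ x ∈ xs ] (f x * c)
  *-distribʳ-∑-list xs c f = trans (*-comm _ c) (trans (*-distribˡ-∑-list xs c f) (∑-list-cong xs (λ x → *-comm c (f x))))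

  ∑-list-const : ∀ (xs : List A) c → ∑[ x ∈ xs ] c ≡ length xs * c
  ∑-list-const []       c = refl
  ∑-list-const (x ∷ xs) c = cong (c +_) (∑-list-const xs c)

  ∑-list-mono : ∀ (xs : List A) {f g : A → ℕ} → (∀ x → f x ≤ g x) → ∑-list xs f ≤ ∑-list xs g
  ∑-list-mono []       f≤g = z≤n
  ∑-list-mono (x ∷ xs) f≤g = +-mono-≤ (f≤g x) (∑-list-mono xs f≤g)

  ∑-list-≥ : ∀ {xs x} (f : A → ℕ) → x ∈ xs → f x ≤ ∑-list xs f
  ∑-list-≥ f (here refl)           = m≤m+n _ _
  ∑-list-≥ {y ∷ _} f (there x∈xs) = ≤-trans (∑-list-≥ f x∈xs) (m≤n+m _ (f y))

  ∑-list-mono-< : ∀ {xs y} {f g : A → ℕ} → (∀ x → f x ≤ g x) → y ∈ xs → f y < g y → ∑-list xs f < ∑-list xs g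
  ∑-list-mono-< {_ ∷ xs} f≤g (here refl)  fy<gy = +-mono-<-≤ fy<gy (∑-list-mono xs f≤g)
  ∑-list-mono-< {x ∷ _}  f≤g (there y∈xs) fy<gy = +-mono-≤-< (f≤g x) (∑-list-mono-< f≤g y∈xs fy<gy)

  length-filterᵇ : ∀ (p : A → Bool) xs → length (filterᵇ p xs) ≡ ∑[ x ∈ xs ] ⟦ p x ⟧
  length-filterᵇ p []       = refl
  length-filterᵇ p (x ∷ xs) with p x
  ... | true  = cong suc (length-filterᵇ p xs)
  ... | false = length-filterᵇ p xs

  ∑-filterᵇ : ∀ (p : A → Bool) xs f → ∑-list (filterᵇ p xs) f ≡ ∑[ x ∈ xs ] (⟦ p x ⟧ * f x)
  ∑-filterᵇ p []       f = refl
  ∑-filterᵇ p (x ∷ xs) f with p x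
  ... | true  = cong₂ _+_ (sym (+-identityʳ (f x))) (∑-filterᵇ p xs f)
  ... | false = ∑-filterᵇ p xs f

  ∑-list-sum-comm : ∀ (xs : List A) n (f : A → Fin n → ℕ) →
                    ∑[ x ∈ xs ] ∑[ i < n ] f x i ≡ ∑[ i < n ] ∑[ x ∈ xs ] f x i
  ∑-list-sum-comm []       n f = sym (sum-replicate-zero n)
  ∑-list-sum-comm (x ∷ xs) n f =
    trans (cong (sum (f x) +_) (∑-list-sum-comm xs n f)) (sym (∑-distrib-+ (f x) _))

module _ {A B : Set} where

  ∑-list-map : ∀ (h : A → B) xs f → ∑-list (map h xs) f ≡ ∑[ x ∈ xs ] f (h x)
  ∑-list-map h []       f = refl
  ∑-list-map h (x ∷ xs) f = cong (f (h x) +_) (∑-list-map h xs f)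

  ∑-concatMap : ∀ (h : A → List B) xs f → ∑-list (concatMap h xs) f ≡ ∑[ x ∈ xs ] ∑-list (h x) f
  ∑-concatMap h []       f = refl
  ∑-concatMap h (x ∷ xs) f = trans (∑-list-++ (h x) _ f) (cong (∑-list (h x) f +_) (∑-concatMap h xs f))

∑-cartesianProduct : ∀ {A B : Set} (xs : List A) (ys : List B) f →
                     ∑-list (cartesianProduct xs ys) f ≡ ∑[ x ∈ xs ] ∑[ y ∈ ys ] f (x , y)
∑-cartesianProduct []       ys f = refl
∑-cartesianProduct (x ∷ xs) ys f =
  trans (∑-list-++ (map (x ,_) ys) _ f) (cong₂ _+_ (∑-list-map (x ,_) ys f) (∑-cartesianProduct xs ys f))

∑-tabulate : ∀ {A : Set} n (g : Fin n → A) f → ∑-list (tabulate g) f ≡ ∑[ i < n ] f (g i)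
∑-tabulate zero    g f = refl
∑-tabulate (suc n) g f = cong (f (g zero) +_) (∑-tabulate n (g ∘ suc) f)

∑-allFin : ∀ n f → ∑-list (allFin n) f ≡ sum f
∑-allFin n = ∑-tabulate n (λ i → i)

∑-const : ∀ n c → ∑[ i < n ] c ≡ n * c
∑-const zero    c = refl
∑-const (suc n) c = cong (c +_) (∑-const n c)

∑-indicator : ∀ n (v : Fin n) → ∑[ w < n ] ⟦ does (w ≟ v) ⟧ ≡ 1
∑-indicator (suc n) zero    = cong suc (sum-replicate-zero n)
∑-indicator (suc n) (suc v) = ∑-indicator n v

∑-≢ : ∀ m (b : Fin m) → ∑[ a < m ] ⟦ not (does (a ≟ b)) ⟧ ≡ m ∸ 1
∑-≢ m b = begin
  ∑[ a < m ] ⟦ not (does (a ≟ b)) ⟧                                 ≡⟨ m+n∸n≡m _ 1 ⟨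
  ∑[ a < m ] ⟦ not (does (a ≟ b)) ⟧ + 1 ∸ 1                         ≡⟨ cong (λ t → ∑[ a < m ] ⟦ not (does (a ≟ b)) ⟧ + t ∸ 1) (∑-indicator m b) ⟨
  ∑[ a < m ] ⟦ not (does (a ≟ b)) ⟧ + ∑[ a < m ] ⟦ does (a ≟ b) ⟧ ∸ 1 ≡⟨ cong (_∸ 1) (∑-distrib-+ {m} _ _) ⟨
  ∑[ a < m ] (⟦ not (does (a ≟ b)) ⟧ + ⟦ does (a ≟ b) ⟧) ∸ 1         ≡⟨ cong (_∸ 1) (sum-cong-≗ {m} (λ a → ⟦not⟧+⟦⟧ (does (a ≟ b)))) ⟩
  ∑[ a < m ] 1 ∸ 1                                                  ≡⟨ cong (_∸ 1) (trans (∑-const m 1) (*-identityʳ m)) ⟩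
  m ∸ 1                                                             ∎
  where
  open ≡-Reasoning
  ⟦not⟧+⟦⟧ : ∀ b → ⟦ not b ⟧ + ⟦ b ⟧ ≡ 1
  ⟦not⟧+⟦⟧ true  = refl
  ⟦not⟧+⟦⟧ false = refl

∑-pick : ∀ n (v : Fin n) (f : Fin n → ℕ) → ∑[ w < n ] (⟦ does (w ≟ v) ⟧ * f w) ≡ f v
∑-pick n v f = begin
  ∑[ w < n ] (⟦ does (w ≟ v) ⟧ * f w) ≡⟨ sum-cong-≗ {n} pick ⟩
  ∑[ w < n ] (⟦ does (w ≟ v) ⟧ * f v) ≡⟨ *-distribʳ-sum {n} (f v) _ ⟨
  ∑[ w < n ] ⟦ does (w ≟ v) ⟧ * f v   ≡⟨ cong (_* f v) (∑-indicator n v) ⟩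
  1 * f v                             ≡⟨ *-identityˡ (f v) ⟩
  f v                                 ∎
  where
  open ≡-Reasoning
  pick : ∀ w → ⟦ does (w ≟ v) ⟧ * f w ≡ ⟦ does (w ≟ v) ⟧ * f v
  pick w with w ≟ v
  ... | yes refl = refl
  ... | no  _    = refl

∑≡0⇒≡0 : ∀ {n} (f : Fin n → ℕ) → sum f ≡ 0 → ∀ u → f u ≡ 0
∑≡0⇒≡0 {suc n} f ∑f≡0 u = m+n≡0⇒m≡0 (f u) (trans (sym (sum-remove {i = u} f)) ∑f≡0)

∑≢0⇒∃≢0 : ∀ {n} (f : Fin n → ℕ) k → sum f ≡ suc k → ∃ λ u → f u ≢ 0
∑≢0⇒∃≢0 {suc n} f k ∑f≡1+k with f zero in eq
... | suc _ = zero , λ f0≡0 → 0≢1+n (trans (sym f0≡0) eq)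
... | zero  = let u , fu≢0 = ∑≢0⇒∃≢0 (f ∘ suc) k ∑f≡1+k in suc u , fu≢0

∑-swap-at : ∀ {n} (v : Fin n) (f g : Fin n → ℕ) → (∀ u → u ≢ v → f u ≡ g u) →
            sum f + g v ≡ sum g + f v
∑-swap-at {suc n} v f g f≡g = begin
  sum f + g v                   ≡⟨ cong (_+ g v) (sum-remove {i = v} f) ⟩
  f v + sum (removeAt f v) + g v ≡⟨ cong (λ s → f v + s + g v) (sum-cong-≗ (λ w → f≡g (punchIn v w) (punchInᵢ≢i v w))) ⟩
  f v + sum (removeAt g v) + g v ≡⟨ outer-swap (f v) _ (g v) ⟩
  g v + sum (removeAt g v) + f v ≡⟨ cong (_+ f v) (sym (sum-remove {i = v} g)) ⟩
  sum g + f v                   ∎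
  where
  open ≡-Reasoning
  outer-swap : ∀ a b c → a + b + c ≡ c + b + a
  outer-swap = solve-∀

module _ {c ℓ} (M : CommutativeMonoid c ℓ) where
  private
    module M = CommutativeMonoid M
    module Σ = MonoidSum M
  open RawMonoid M.rawMonoid using () renaming (_×_ to _·_)

  sum-except : ∀ {j} (t : Vector M.Carrier (suc j)) i c →
               (∀ w → w ≢ i → t w M.≈ c) → Σ.sum t M.≈ t i M.∙ (j · c)
  sum-except {j} t i c t≈c = M.trans (Σ.sum-remove {i = i} t)
    (M.∙-congˡ (M.trans (Σ.sum-cong-≋ (λ w → t≈c (punchIn i w) (punchInᵢ≢i i w))) (Σ.sum-replicate j)))

  sum-except₂ : ∀ {j} (t : Vector M.Carrier (suc (suc j))) {i i'} c → i ≢ i' →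
                (∀ w → w ≢ i → w ≢ i' → t w M.≈ c) → Σ.sum t M.≈ t i M.∙ (t i' M.∙ (j · c))
  sum-except₂ t {i} {i'} c i≢i' t≈c = M.trans (Σ.sum-remove {i = i} t) (M.∙-congˡ
    (M.trans (sum-except (removeAt t i) (punchOut i≢i') c rest) (M.∙-congʳ (M.reflexive (cong t (punchIn-punchOut i≢i'))))))
    where
    rest : ∀ w → w ≢ punchOut i≢i' → t (punchIn i w) M.≈ c
    rest w w≢ = t≈c (punchIn i w) (punchInᵢ≢i i w)
      (λ eq → w≢ (punchIn-injective i w _ (trans eq (sym (punchIn-punchOut i≢i')))))

private
  open RawMonoid +-0-rawMonoid using () renaming (_×_ to _×₊_)
  open RawMonoid *-1-rawMonoid using () renaming (_×_ to _×*_)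

  ×₊≡* : ∀ j c → j ×₊ c ≡ j * c
  ×₊≡* zero    c = refl
  ×₊≡* (suc j) c = cong (c +_) (×₊≡* j c)

  ×*≡^ : ∀ j c → j ×* c ≡ c ^ j
  ×*≡^ zero    c = refl
  ×*≡^ (suc j) c = cong (c *_) (×*≡^ j c)

∑-except : ∀ {j} (f : Fin (suc j) → ℕ) i c → (∀ w → w ≢ i → f w ≡ c) → sum f ≡ f i + j * c
∑-except {j} f i c f≡c = trans (sum-except +-0-commutativeMonoid f i c f≡c) (cong (f i +_) (×₊≡* j c))

∑-except₂ : ∀ {j} (f : Fin (suc (suc j)) → ℕ) {i i'} c → i ≢ i' →
            (∀ w → w ≢ i → w ≢ i' → f w ≡ c) → sum f ≡ f i + (f i' + j * c)
∑-except₂ {j} f {i} {i'} c i≢i' f≡c =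
  trans (sum-except₂ +-0-commutativeMonoid f c i≢i' f≡c) (cong (λ t → f i + (f i' + t)) (×₊≡* j c))

∏-const : ∀ n c → product {n} (λ _ → c) ≡ c ^ n
∏-const n c = trans (MonoidSum.sum-replicate *-1-commutativeMonoid n) (×*≡^ n c)

∏-except : ∀ {j} (f : Fin (suc j) → ℕ) i c → (∀ w → w ≢ i → f w ≡ c) → product f ≡ f i * c ^ j
∏-except {j} f i c f≡c = trans (sum-except *-1-commutativeMonoid f i c f≡c) (cong (f i *_) (×*≡^ j c))

∏-except₂ : ∀ {j} (f : Fin (suc (suc j)) → ℕ) {i i'} c → i ≢ i' →
            (∀ w → w ≢ i → w ≢ i' → f w ≡ c) → product f ≡ f i * (f i' * c ^ j)
∏-except₂ {j} f {i} {i'} c i≢i' f≡c =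
  trans (sum-except₂ *-1-commutativeMonoid f c i≢i' f≡c) (cong (λ t → f i * (f i' * t)) (×*≡^ j c))

∑-allVecs-product : ∀ n m (h : Fin n → Fin m → ℕ) →
  ∑[ g ∈ allVecs n m ] product (λ w → h w (lookup g w)) ≡ product (λ w → sum (h w))
∑-allVecs-product zero    m h = refl
∑-allVecs-product (suc n) m h = begin
  ∑-list (allVecs (suc n) m) (λ g → h zero (lookup g zero) * P g)
    ≡⟨ ∑-concatMap (λ a → map (a ∷ᵥ_) (allVecs n m)) (allFin m) _ ⟩
  ∑[ a ∈ allFin m ] ∑-list (map (a ∷ᵥ_) (allVecs n m)) (λ g → h zero (lookup g zero) * P g)
    ≡⟨ ∑-list-cong (allFin m) (λ a → ∑-list-map (a ∷ᵥ_) (allVecs n m) _) ⟩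
  ∑[ a ∈ allFin m ] ∑[ g ∈ allVecs n m ] (h zero a * P (a ∷ᵥ g))
    ≡⟨ ∑-list-cong (allFin m) (λ a → sym (*-distribˡ-∑-list (allVecs n m) (h zero a) _)) ⟩
  ∑[ a ∈ allFin m ] (h zero a * ∑[ g ∈ allVecs n m ] P (a ∷ᵥ g))
    ≡⟨ ∑-allFin m _ ⟩
  ∑[ a < m ] (h zero a * ∑[ g ∈ allVecs n m ] P (a ∷ᵥ g))
    ≡⟨ sym (*-distribʳ-sum {m} _ (h zero)) ⟩
  sum (h zero) * ∑[ g ∈ allVecs n m ] product (λ w → h (suc w) (lookup g w))
    ≡⟨ cong (sum (h zero) *_) (∑-allVecs-product n m (h ∘ suc)) ⟩
  product (λ w → sum (h w)) ∎
  where
  open ≡-Reasoning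
  P : Vec (Fin m) (suc n) → ℕ
  P g = product (λ w → h (suc w) (lookup g (suc w)))

onlyAt : ∀ {n} {A : Set} → Fin n → (A → ℕ) → Fin n → A → ℕ
onlyAt v φ w = if does (w ≟ v) then φ else λ _ → 1

onlyAt-≡ : ∀ {n} {A : Set} (v : Fin n) (φ : A → ℕ) a → onlyAt v φ v a ≡ φ a
onlyAt-≡ v φ a rewrite dec-true (v ≟ v) refl = refl

onlyAt-≢ : ∀ {n} {A : Set} {v w : Fin n} (φ : A → ℕ) a → w ≢ v → onlyAt v φ w a ≡ 1
onlyAt-≢ {v = v} {w} φ a w≢v rewrite dec-false (w ≟ v) w≢v = refl

∏-onlyAt : ∀ {n} {A : Set} (v : Fin n) (φ : A → ℕ) (g : Fin n → A) → product (λ w → onlyAt v φ w (g w)) ≡ φ (g v)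
∏-onlyAt {suc j} v φ g = begin
  product (λ w → onlyAt v φ w (g w)) ≡⟨ ∏-except _ v 1 (λ w w≢v → onlyAt-≢ φ (g w) w≢v) ⟩
  onlyAt v φ v (g v) * 1 ^ j         ≡⟨ cong₂ _*_ (onlyAt-≡ v φ (g v)) (^-zeroˡ j) ⟩
  φ (g v) * 1                      ≡⟨ *-identityʳ (φ (g v)) ⟩
  φ (g v)                          ∎
  where open ≡-Reasoning

∑-onlyAt-≢ : ∀ {n} m {v w : Fin n} (φ : Fin m → ℕ) → w ≢ v → sum (onlyAt v φ w) ≡ m
∑-onlyAt-≢ m φ w≢v = trans (sum-cong-≗ {m} (λ a → onlyAt-≢ φ a w≢v)) (trans (∑-const m 1) (*-identityʳ m))

∑-allVecs-coord : ∀ {j} m (v : Fin (suc j)) (φ : Fin m → ℕ) →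
                  ∑[ g ∈ allVecs (suc j) m ] φ (lookup g v) ≡ sum φ * m ^ j
∑-allVecs-coord {j} m v φ = begin
  ∑[ g ∈ allVecs (suc j) m ] φ (lookup g v)
    ≡⟨ ∑-list-cong (allVecs (suc j) m) (λ g → sym (∏-onlyAt v φ (lookup g))) ⟩
  ∑[ g ∈ allVecs (suc j) m ] product (λ w → onlyAt v φ w (lookup g w))
    ≡⟨ ∑-allVecs-product (suc j) m (onlyAt v φ) ⟩
  product (λ w → sum (onlyAt v φ w))
    ≡⟨ ∏-except _ v m (λ w → ∑-onlyAt-≢ m φ) ⟩
  sum (onlyAt v φ v) * m ^ j
    ≡⟨ cong (_* m ^ j) (sum-cong-≗ {m} (onlyAt-≡ v φ)) ⟩
  sum φ * m ^ j ∎
  where open ≡-Reasoning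

∑-allVecs-coord₂ : ∀ {j} m {v v' : Fin (suc (suc j))} (φ ψ : Fin m → ℕ) → v ≢ v' →
  ∑[ g ∈ allVecs (suc (suc j)) m ] (φ (lookup g v) * ψ (lookup g v')) ≡ sum φ * (sum ψ * m ^ j)
∑-allVecs-coord₂ {j} m {v} {v'} φ ψ v≢v' = begin
  ∑[ g ∈ allVecs (suc (suc j)) m ] (φ (lookup g v) * ψ (lookup g v'))
    ≡⟨ ∑-list-cong (allVecs (suc (suc j)) m) (λ g → sym (pointwise (lookup g))) ⟩
  ∑[ g ∈ allVecs (suc (suc j)) m ] product (λ w → h w (lookup g w))
    ≡⟨ ∑-allVecs-product (suc (suc j)) m h ⟩
  product (λ w → sum (h w))
    ≡⟨ ∏-except₂ _ m v≢v' off-v-v' ⟩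
  sum (h v) * (sum (h v') * m ^ j)
    ≡⟨ cong₂ (λ s t → s * (t * m ^ j)) (sum-cong-≗ {m} at-v) (sum-cong-≗ {m} at-v') ⟩
  sum φ * (sum ψ * m ^ j) ∎
  where
  open ≡-Reasoning
  h : Fin (suc (suc j)) → Fin m → ℕ
  h w a = onlyAt v φ w a * onlyAt v' ψ w a
  pointwise : ∀ g → product (λ w → h w (g w)) ≡ φ (g v) * ψ (g v')
  pointwise g = trans (∏-distrib-* (λ w → onlyAt v φ w (g w)) (λ w → onlyAt v' ψ w (g w)))
                      (cong₂ _*_ (∏-onlyAt v φ g) (∏-onlyAt v' ψ g))
  off-v-v' : ∀ w → w ≢ v → w ≢ v' → sum (h w) ≡ m
  off-v-v' w w≢v w≢v' =
    trans (sum-cong-≗ {m} (λ a → trans (cong (_* _) (onlyAt-≢ φ a w≢v)) (*-identityˡ _))) (∑-onlyAt-≢ m ψ w≢v')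
  at-v : ∀ a → h v a ≡ φ a
  at-v a = trans (cong₂ _*_ (onlyAt-≡ v φ a) (onlyAt-≢ ψ a v≢v')) (*-identityʳ (φ a))
  at-v' : ∀ a → h v' a ≡ ψ a
  at-v' a = trans (cong₂ _*_ (onlyAt-≢ φ a (v≢v' ∘ sym)) (onlyAt-≡ v' ψ a)) (*-identityˡ (ψ a))

⟦all-tabulate⟧ : ∀ {A : Set} n (g : Fin n → A) p → ⟦ all p (tabulate g) ⟧ ≡ product (λ w → ⟦ p (g w) ⟧)
⟦all-tabulate⟧ zero    g p = refl
⟦all-tabulate⟧ (suc n) g p = trans (⟦∧⟧ (p (g zero)) _) (cong (⟦ p (g zero) ⟧ *_) (⟦all-tabulate⟧ n (g ∘ suc) p))

agreesOffᵇ : ∀ {n m} → Fin n → Vec (Fin m) n → Vec (Fin m) n → Bool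
agreesOffᵇ {n} v f f' = all (λ w → does (w ≟ v) ∨ does (lookup f w ≟ lookup f' w)) (allFin n)

∈-allVecs : ∀ {n m} (f : Vec (Fin m) n) → f ∈ allVecs n m
∈-allVecs []ᵥ       = here refl
∈-allVecs {suc n} {m} (a ∷ᵥ f) =
  ∈-concatMap⁺ (λ b → map (b ∷ᵥ_) (allVecs n m)) (Any.map (λ { refl → ∈-map⁺ (a ∷ᵥ_) (∈-allVecs f) }) (∈-allFin a))

lookup-ext : ∀ {n m} {f f' : Vec (Fin m) n} → (∀ u → lookup f u ≡ lookup f' u) → f ≡ f'
lookup-ext {f = f} {f'} f≗f' = trans (sym (VecP.tabulate∘lookup f)) (trans (VecP.tabulate-cong f≗f') (VecP.tabulate∘lookup f'))

AgreeOff : ∀ {n m} → Fin n → Vec (Fin m) n → Vec (Fin m) n → Set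
AgreeOff v f f' = ∀ u → u ≢ v → lookup f u ≡ lookup f' u

agreesOffᵇ⇒ : ∀ {n m} {v : Fin n} {f f' : Vec (Fin m) n} → agreesOffᵇ v f f' ≡ true → AgreeOff v f f'
agreesOffᵇ⇒ {v = v} {f} {f'} agree u u≢v with all-true⁻ _ (allFin _) agree (∈-allFin u)
... | agree-at-u rewrite dec-false (u ≟ v) u≢v = does⇒ (lookup f u ≟ lookup f' u) agree-at-u

agreesOffᵇ⇐ : ∀ {n m} {v : Fin n} {f f' : Vec (Fin m) n} → AgreeOff v f f' → agreesOffᵇ v f f' ≡ true
agreesOffᵇ⇐ {v = v} {f} {f'} agree = all-true⁺ _ (allFin _) λ {u} _ → at u
  where
  at : ∀ u → (does (u ≟ v) ∨ does (lookup f u ≟ lookup f' u)) ≡ true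
  at u with u ≟ v
  ... | yes _   = refl
  ... | no u≢v = dec-true (lookup f u ≟ lookup f' u) (agree u u≢v)

∑-allVecs-agreesOff : ∀ {n m} (v : Fin n) (f : Vec (Fin m) n) (G : Fin m → ℕ) →
  ∑[ f' ∈ allVecs n m ] (⟦ agreesOffᵇ v f f' ⟧ * G (lookup f' v)) ≡ sum G
∑-allVecs-agreesOff {suc j} {m} v f G = begin
  ∑[ f' ∈ allVecs (suc j) m ] (⟦ agreesOffᵇ v f f' ⟧ * G (lookup f' v))
    ≡⟨ ∑-list-cong (allVecs (suc j) m) (λ f' → sym (pointwise f')) ⟩
  ∑[ f' ∈ allVecs (suc j) m ] product (λ w → h w (lookup f' w))
    ≡⟨ ∑-allVecs-product (suc j) m h ⟩
  product (λ w → sum (h w))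
    ≡⟨ ∏-except _ v 1 off-v ⟩
  sum (h v) * 1 ^ j
    ≡⟨ cong₂ _*_ (sum-cong-≗ {m} at-v) (^-zeroˡ j) ⟩
  sum G * 1
    ≡⟨ *-identityʳ (sum G) ⟩
  sum G ∎
  where
  open ≡-Reasoning
  agrees : Fin (suc j) → Fin m → Bool
  agrees w a = does (w ≟ v) ∨ does (lookup f w ≟ a)
  h : Fin (suc j) → Fin m → ℕ
  h w a = ⟦ agrees w a ⟧ * onlyAt v G w a
  pointwise : ∀ f' → product (λ w → h w (lookup f' w)) ≡ ⟦ agreesOffᵇ v f f' ⟧ * G (lookup f' v)
  pointwise f' = trans (∏-distrib-* (λ w → ⟦ agrees w (lookup f' w) ⟧) (λ w → onlyAt v G w (lookup f' w))) (cong₂ _*_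
    (sym (⟦all-tabulate⟧ (suc j) (λ w → w) (λ w → agrees w (lookup f' w)))) (∏-onlyAt v G (lookup f')))
  at-v : ∀ a → h v a ≡ G a
  at-v a = trans (cong₂ _*_ (cong (λ b → ⟦ b ∨ does (lookup f v ≟ a) ⟧) (dec-true (v ≟ v) refl)) (onlyAt-≡ v G a)) (*-identityˡ (G a))
  off-v : ∀ w → w ≢ v → sum (h w) ≡ 1
  off-v w w≢v = begin
    sum (h w)
      ≡⟨ sum-cong-≗ {m} (λ a → cong₂ _*_ (cong (λ b → ⟦ b ∨ _ ⟧) (dec-false (w ≟ v) w≢v)) (onlyAt-≢ G a w≢v)) ⟩
    ∑[ a < m ] (⟦ does (lookup f w ≟ a) ⟧ * 1) ≡⟨ sum-cong-≗ {m} (λ a → trans (*-identityʳ _) (cong ⟦_⟧ (does-sym (lookup f w) a))) ⟩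
    ∑[ a < m ] ⟦ does (a ≟ lookup f w) ⟧   ≡⟨ ∑-indicator m (lookup f w) ⟩
    1                                  ∎

⟦≡-dec⟧ : ∀ {n m} (f f' : Vec (Fin m) n) →
          ⟦ does (VecP.≡-dec _≟_ f f') ⟧ ≡ product (λ w → ⟦ does (lookup f w ≟ lookup f' w) ⟧)
⟦≡-dec⟧ []ᵥ       []ᵥ         = refl
⟦≡-dec⟧ (a ∷ᵥ f) (b ∷ᵥ f') = trans (⟦∧⟧ (does (a ≟ b)) _) (cong (⟦ does (a ≟ b) ⟧ *_) (⟦≡-dec⟧ f f'))

∑-allVecs-≡ : ∀ n m (f : Vec (Fin m) n) → ∑[ f' ∈ allVecs n m ] ⟦ does (VecP.≡-dec _≟_ f f') ⟧ ≡ 1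
∑-allVecs-≡ n m f = begin
  ∑[ f' ∈ allVecs n m ] ⟦ does (VecP.≡-dec _≟_ f f') ⟧
    ≡⟨ ∑-list-cong (allVecs n m) (⟦≡-dec⟧ f) ⟩
  ∑[ f' ∈ allVecs n m ] product (λ w → ⟦ does (lookup f w ≟ lookup f' w) ⟧)
    ≡⟨ ∑-allVecs-product n m (λ w a → ⟦ does (lookup f w ≟ a) ⟧) ⟩
  product (λ w → ∑[ a < m ] ⟦ does (lookup f w ≟ a) ⟧)
    ≡⟨ product-cong-≗ {n} (λ w → trans (sum-cong-≗ {m} (λ a → cong ⟦_⟧ (does-sym (lookup f w) a))) (∑-indicator m (lookup f w))) ⟩
  product {n} (λ _ → 1)
    ≡⟨ trans (∏-const n 1) (^-zeroˡ n) ⟩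
  1 ∎
  where open ≡-Reasoning

length-allVecs : ∀ n m → length (allVecs n m) ≡ m ^ n
length-allVecs n m = begin
  length (allVecs n m)                               ≡⟨ sym (*-identityʳ _) ⟩
  length (allVecs n m) * 1                           ≡⟨ sym (∑-list-const (allVecs n m) 1) ⟩
  ∑[ g ∈ allVecs n m ] 1                             ≡⟨ ∑-list-cong (allVecs n m) (λ _ → sym (trans (∏-const n 1) (^-zeroˡ n))) ⟩
  ∑[ g ∈ allVecs n m ] product {n} (λ _ → 1)         ≡⟨ ∑-allVecs-product n m (λ _ _ → 1) ⟩
  product {n} (λ _ → ∑[ a < m ] 1)                   ≡⟨ trans (∏-const n _) (cong (_^ n) (trans (∑-const m 1) (*-identityʳ m))) ⟩
  m ^ n                                              ∎
  where open ≡-Reasoning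

-- Geodesic distance in a finite graph

length-takeWhileᵇ-applyUpTo : ∀ (P : ℕ → Bool) (f : ℕ → ℕ) d N →
  (∀ k → k < d → P (f k) ≡ true) → P (f d) ≡ false → d < N →
  length (takeWhileᵇ P (applyUpTo f N)) ≡ d
length-takeWhileᵇ-applyUpTo P f zero    (suc N) _   Pd≡f _         rewrite Pd≡f = refl
length-takeWhileᵇ-applyUpTo P f (suc d) (suc N) P<d Pd≡f (s≤s d<N) rewrite P<d 0 (s≤s z≤n) =
  cong suc (length-takeWhileᵇ-applyUpTo P (f ∘ suc) d N (λ k k<d → P<d (suc k) (s≤s k<d)) Pd≡f d<N)

record IsDistanceFrom (X : Graph) (x : V X) (Ψ : V X → ℕ) : Set where
  field
    source      : Ψ x ≡ 0
    zero⇒source : ∀ y → Ψ y ≡ 0 → y ≡ x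
    edge-≤      : ∀ z y → adj X z y ≡ true → Ψ y ≤ suc (Ψ z)
    descent     : ∀ k y → Ψ y ≡ suc k → ∃ λ z → adj X z y ≡ true × Ψ z ≡ k

module Reach (X : Graph) (x : V X) where

  Reaches : ℕ → V X → Set
  Reaches k y = reach X k x y ≡ true

  reach-refl : Reaches 0 x
  reach-refl = dec-true (_≟V_ X x x) refl

  reach-zero⁻ : ∀ {y} → Reaches 0 y → x ≡ y
  reach-zero⁻ {y} = does⇒ (_≟V_ X x y)

  reach-suc : ∀ k {y} → Reaches k y → Reaches (suc k) y
  reach-suc k r rewrite r = refl

  reach-mono : ∀ {k k' y} → k ≤′ k' → Reaches k y → Reaches k' y
  reach-mono             ≤′-refl         r = r
  reach-mono {k' = suc k'} (≤′-step k≤′k') r = reach-suc k' (reach-mono k≤′k' r)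

  reach-snoc : ∀ k {z y} → z ∈ verts X → Reaches k z → adj X z y ≡ true → Reaches (suc k) y
  reach-snoc k {z} {y} z∈ r a with reach X k x y
  ... | true  = refl
  ... | false = any-true⁺ (λ w → reach X k x w ∧ adj X w y) z∈ (cong₂ _∧_ r a)

  reach-suc⁻ : ∀ k {y} → Reaches (suc k) y → Reaches k y ⊎ ∃ λ z → Reaches k z × adj X z y ≡ true
  reach-suc⁻ k {y} r with ∨-true⁻ {reach X k x y} r
  ... | inj₁ r' = inj₁ r'
  ... | inj₂ r' = let z , _ , rz∧a = any-true⁻ (λ w → reach X k x w ∧ adj X w y) (verts X) r' in inj₂ (z , ∧-true⁻ rz∧a)

IsDistanceFrom-cong : ∀ {X x} {Ψ Φ : V X → ℕ} → (∀ y → Ψ y ≡ Φ y) → IsDistanceFrom X x Ψ → IsDistanceFrom X x Φ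
IsDistanceFrom-cong {Ψ = Ψ} {Φ} Ψ≗Φ isDist = record
  { source      = trans (sym (Ψ≗Φ _)) source
  ; zero⇒source = λ y Φy≡0 → zero⇒source y (trans (Ψ≗Φ y) Φy≡0)
  ; edge-≤      = λ z y a → subst₂ (λ s t → s ≤ suc t) (Ψ≗Φ y) (Ψ≗Φ z) (edge-≤ z y a)
  ; descent     = λ k y Φy≡1+k → let z , a , Ψz≡k = descent k y (trans (Ψ≗Φ y) Φy≡1+k) in z , a , trans (sym (Ψ≗Φ z)) Ψz≡k
  }
  where open IsDistanceFrom isDist

module DistanceFrom (X : Graph) (complete : ∀ y → y ∈ verts X) (x : V X) where
  open Reach X x

  module _ {Ψ : V X → ℕ} (isDist : IsDistanceFrom X x Ψ) where
    open IsDistanceFrom isDist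

    reach⇒label≤ : ∀ k {y} → Reaches k y → Ψ y ≤ k
    reach⇒label≤ zero    r rewrite sym (reach-zero⁻ r) = ≤-reflexive source
    reach⇒label≤ (suc k) {y} r with reach-suc⁻ k r
    ... | inj₁ r'           = m≤n⇒m≤1+n (reach⇒label≤ k r')
    ... | inj₂ (z , rz , a) = ≤-trans (edge-≤ z y a) (s≤s (reach⇒label≤ k rz))

    reach-label : ∀ k y → Ψ y ≡ k → Reaches k y
    reach-label zero    y Ψy≡0 rewrite zero⇒source y Ψy≡0 = reach-refl
    reach-label (suc k) y Ψy≡1+k =
      let z , a , Ψz≡k = descent k y Ψy≡1+k in reach-snoc k (complete z) (reach-label k z Ψz≡k) a

    label-level : ∀ d k y → Ψ y ≡ d + k → ∃ λ z → Ψ z ≡ k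
    label-level zero    k y Ψy≡k   = y , Ψy≡k
    label-level (suc d) k y Ψy≡1+d+k = let z , _ , Ψz≡d+k = descent (d + k) y Ψy≡1+d+k in label-level d k z Ψz≡d+k

    ball : ℕ → ℕ
    ball k = ∑[ w ∈ verts X ] ⟦ does (Ψ w ≤? k) ⟧

    ball≤length : ∀ k → ball k ≤ length (verts X)
    ball≤length k = ≤-trans (∑-list-mono (verts X) (λ w → ⟦⟧≤1 _)) (≤-reflexive (trans (∑-list-const (verts X) 1) (*-identityʳ _)))

    -- Every layer up to Ψ y is inhabited, so the balls strictly grow until then.
    ball-grows : ∀ k y → k ≤ Ψ y → suc k ≤ ball k
    ball-grows zero y _ = ≤-trans (≤-reflexive (cong ⟦_⟧ (sym (dec-true (Ψ x ≤? 0) (≤-reflexive source)))))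
                                  (∑-list-≥ (λ w → ⟦ does (Ψ w ≤? 0) ⟧) (complete x))
    ball-grows (suc k) y k<Ψy with label-level (Ψ y ∸ suc k) (suc k) y (sym (m∸n+n≡m k<Ψy))
    ... | z , Ψz≡1+k = ≤-trans (s≤s (ball-grows k y (<⇒≤ k<Ψy))) (∑-list-mono-< grow (complete z) new)
      where
      grow : ∀ w → ⟦ does (Ψ w ≤? k) ⟧ ≤ ⟦ does (Ψ w ≤? suc k) ⟧
      grow w = ⟦⟧-mono (λ t → dec-true (Ψ w ≤? suc k) (m≤n⇒m≤1+n (does⇒ (Ψ w ≤? k) t)))
      new : ⟦ does (Ψ z ≤? k) ⟧ < ⟦ does (Ψ z ≤? suc k) ⟧
      new = subst₂ _<_ (cong ⟦_⟧ (sym (dec-false (Ψ z ≤? k) (λ Ψz≤k → n≮n k (subst (_≤ k) Ψz≡1+k Ψz≤k)))))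
                       (cong ⟦_⟧ (sym (dec-true (Ψ z ≤? suc k) (≤-reflexive Ψz≡1+k)))) (s≤s z≤n)

    label<length : ∀ y → Ψ y < length (verts X)
    label<length y = ≤-trans (ball-grows (Ψ y) y ≤-refl) (ball≤length (Ψ y))

    dist≡label : ∀ y → dist X x y ≡ Ψ y
    dist≡label y = length-takeWhileᵇ-applyUpTo (λ k → not (reach X k x y)) (λ k → k) (Ψ y) _ below at (label<length y)
      where
      below : ∀ k → k < Ψ y → not (reach X k x y) ≡ true
      below k k<Ψy with reach X k x y in r
      ... | false = refl
      ... | true  = ⊥-elim (<⇒≱ k<Ψy (reach⇒label≤ k r))
      at : not (reach X (Ψ y) x y) ≡ false
      at rewrite reach-label (Ψ y) y refl = refl

  module _ (reachable : ∀ y → ∃ λ k → Reaches k y) where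

    first-reach : ∀ y k → Reaches k y → ∃ λ d → Reaches d y × (∀ j → j < d → reach X j x y ≡ false)
    first-reach y zero    r = 0 , r , λ _ ()
    first-reach y (suc k) r = by-cases (reach X k x y) refl
      where
      by-cases : ∀ b → reach X k x y ≡ b → ∃ λ d → Reaches d y × (∀ j → j < d → reach X j x y ≡ false)
      by-cases true  rk = first-reach y k rk
      by-cases false rk = suc k , r , below
        where
        below : ∀ j → j < suc k → reach X j x y ≡ false
        below j (s≤s j≤k) with reach X j x y in rj
        ... | false = refl
        ... | true  = ⊥-elim (true≢false (trans (sym (reach-mono (≤⇒≤′ j≤k) rj)) rk))

    private
      first : ∀ y → ∃ λ d → Reaches d y × (∀ j → j < d → reach X j x y ≡ false)
      first y = first-reach y (proj₁ (reachable y)) (proj₂ (reachable y))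

    reachTime : V X → ℕ
    reachTime y = proj₁ (first y)

    reachTime-reaches : ∀ y → Reaches (reachTime y) y
    reachTime-reaches y = proj₁ (proj₂ (first y))

    reachTime-least : ∀ k y → Reaches k y → reachTime y ≤ k
    reachTime-least k y r with reachTime y ≤? k
    ... | yes ty≤k = ty≤k
    ... | no  ty≰k = ⊥-elim (true≢false (trans (sym r) (proj₂ (proj₂ (first y)) k (≰⇒> ty≰k))))

    isDistanceFrom-reachTime : IsDistanceFrom X x reachTime
    isDistanceFrom-reachTime = record
      { source      = n≤0⇒n≡0 (reachTime-least 0 x reach-refl)
      ; zero⇒source = λ y t≡0 → sym (reach-zero⁻ (subst (λ k → Reaches k y) t≡0 (reachTime-reaches y)))
      ; edge-≤      = edge-≤
      ; descent     = descent
      }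
      where
      edge-≤ : ∀ z y → adj X z y ≡ true → reachTime y ≤ suc (reachTime z)
      edge-≤ z y a = reachTime-least (suc (reachTime z)) y (reach-snoc (reachTime z) (complete z) (reachTime-reaches z) a)
      descent : ∀ k y → reachTime y ≡ suc k → ∃ λ z → adj X z y ≡ true × reachTime z ≡ k
      descent k y ty≡1+k with reach-suc⁻ k (subst (λ d → Reaches d y) ty≡1+k (reachTime-reaches y))
      ... | inj₁ rk = ⊥-elim (<⇒≱ (subst (k <_) (sym ty≡1+k) ≤-refl) (reachTime-least k y rk))
      ... | inj₂ (z , rz , a) = z , a , ≤-antisym (reachTime-least k z rz) k≤tz
        where
        k≤tz : k ≤ reachTime z
        k≤tz with k ≤? reachTime z
        ... | yes k≤tz = k≤tz
        ... | no  k≰tz = ⊥-elim (1+n≰n (≤-trans (≤-trans (≤-reflexive (sym ty≡1+k)) (edge-≤ z y a)) (≰⇒> k≰tz)))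

    isDistanceFrom-dist : IsDistanceFrom X x (dist X x)
    isDistanceFrom-dist = IsDistanceFrom-cong (λ y → sym (dist≡label isDistanceFrom-reachTime y)) isDistanceFrom-reachTime

module _ {m} {aH : Adj m} where
  open Reach (finGraph m aH)

  walk⇒reach : ∀ a k {b c} → Reaches a k c → Walk aH c b → ∃ λ k' → Reaches a k' b
  walk⇒reach a k         r here                = k , r
  walk⇒reach a k {c = c} r (step c~d walk) = walk⇒reach a (suc k) (reach-snoc a k (∈-allFin c) r c~d) walk

  isDistanceFrom-dist-connected : IsConnected aH → ∀ a → IsDistanceFrom (finGraph m aH) a (dist (finGraph m aH) a)
  isDistanceFrom-dist-connected connected a =
    DistanceFrom.isDistanceFrom-dist (finGraph m aH) ∈-allFin a (λ b → walk⇒reach a 0 (reach-refl a) (connected a b))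

-- The wreath product Kₙ ≀ H

-- A shortest walk in Kₙ from x to v through c further vertices has c + 1 edges,
-- except that it is empty when x = v and c = 0.
tourLength : Bool → ℕ → ℕ
tourLength true  zero    = 0
tourLength true  (suc c) = suc (suc c)
tourLength false c       = suc c

tourLength-suc : ∀ b c → tourLength b (suc c) ≡ suc (suc c)
tourLength-suc true  c = refl
tourLength-suc false c = refl

tourLength-≤ : ∀ b c → tourLength b c ≤ suc c
tourLength-≤ true  zero    = z≤n
tourLength-≤ true  (suc c) = ≤-refl
tourLength-≤ false c       = ≤-refl

open-≤-closed : ∀ {c' c} → c' ≤ c → tourLength false c' ≤ suc (tourLength true c)
open-≤-closed {c = zero}  z≤n    = ≤-refl
open-≤-closed {c = suc c} c'≤1+c = m≤n⇒m≤1+n (s≤s c'≤1+c)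

closed<open⇒≡0 : ∀ {c' c} → c' ≤ c → tourLength true c < suc c' → c ≡ 0
closed<open⇒≡0 {c = zero}  _    _  = refl
closed<open⇒≡0 {c = suc c} c'≤c lt = ⊥-elim (1+n≰n (≤-trans (≤-pred lt) c'≤c))

open<closed : ∀ c' e → (suc c' <ᵇ tourLength true (c' + ⟦ e ⟧)) ≡ e
open<closed c'      true  rewrite +-comm c' 1 = dec-true (suc c' <? suc (suc c')) ≤-refl
open<closed zero    false = refl
open<closed (suc k) false rewrite +-identityʳ k = dec-false (suc (suc k) <? suc (suc k)) (n≮n _)

open<open : ∀ {a a'} b b' → a + ⟦ b ⟧ ≡ a' + ⟦ b' ⟧ → (suc a <ᵇ suc a') ≡ b ∧ not b'
open<open {a} {a'} true  true  e rewrite +-cancelʳ-≡ 1 a a' e = dec-false (suc a' <? suc a') (n≮n _)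
open<open {a} {a'} false false e rewrite +-cancelʳ-≡ 0 a a' e = dec-false (suc a' <? suc a') (n≮n _)
open<open {a} {a'} true  false e = dec-true (suc a <? suc a') (s≤s (≤-reflexive (trans (+-comm 1 a) (trans e (+-identityʳ a')))))
open<open {a} {a'} false true  e = dec-false (suc a <? suc a') (λ lt → <⇒≱ lt (s≤s (≤-trans (n≤1+n a') (≤-reflexive 1+a'≡a))))
  where
  1+a'≡a : suc a' ≡ a
  1+a'≡a = trans (+-comm 1 a') (trans (sym e) (+-identityʳ a))

module Wreath {n m : ℕ} (aH : Adj m) (connected : IsConnected aH) where

  H : Graph
  H = finGraph m aH

  W : Graph
  W = wreath n m (completeAdj n) aH

  Config : Set
  Config = Vec (Fin m) n

  dH : Fin m → Fin m → ℕ
  dH = dist H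

  module dH (a : Fin m) = IsDistanceFrom (isDistanceFrom-dist-connected connected a)

  layerDistance : Config → Config → ℕ
  layerDistance g f = ∑[ u < n ] dH (lookup g u) (lookup f u)

  differs : Config → Config → Fin n → Bool
  differs g f u = not (does (lookup g u ≟ lookup f u))

  mustVisit : Config → Config → Fin n → Fin n → Fin n → Bool
  mustVisit g f x v u = not (does (u ≟ x)) ∧ not (does (u ≟ v)) ∧ differs g f u

  detours : Config → Config → Fin n → Fin n → ℕ
  detours g f x v = ∑[ u < n ] ⟦ mustVisit g f x v u ⟧

  tour : Config → Config → Fin n → Fin n → ℕ
  tour g f x v = tourLength (does (x ≟ v)) (detours g f x v)

  wreathDistance : Config → Fin n → Config × Fin n → ℕ
  wreathDistance g x (f , v) = layerDistance g f + tour g f x v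

  verts-complete : ∀ y → y ∈ verts W
  verts-complete (f , v) = ∈-cartesianProduct⁺ (∈-allVecs f) (∈-allFin v)

  adj-cases : ∀ {f' v' f v} → adj W (f' , v') (f , v) ≡ true →
              (v' ≡ v × AgreeOff v' f' f × aH (lookup f' v') (lookup f v') ≡ true) ⊎ (f' ≡ f × v' ≢ v)
  adj-cases {f'} {v'} {f} {v} a with ∨-true⁻ {does (v' ≟ v) ∧ agreesOffᵇ v' f' f ∧ aH (lookup f' v') (lookup f v')} a
  ... | inj₁ layer = let v'≡v , rest = ∧-true⁻ {does (v' ≟ v)} layer
                         agree , a' = ∧-true⁻ {agreesOffᵇ v' f' f} rest
                     in inj₁ (does⇒ (v' ≟ v) v'≡v , agreesOffᵇ⇒ {f = f'} {f} agree , a')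
  ... | inj₂ move  = let f'≡f , v'≢v = ∧-true⁻ {does (VecP.≡-dec _≟_ f' f)} move
                     in inj₂ (does⇒ (VecP.≡-dec _≟_ f' f) f'≡f , not-does⇒ (v' ≟ v) v'≢v)

  adj-layer : ∀ f v c → aH c (lookup f v) ≡ true → adj W (f [ v ]≔ c , v) (f , v) ≡ true
  adj-layer f v c a
    rewrite dec-true (v ≟ v) refl | VecP.lookup∘update v f c | a
          | agreesOffᵇ⇐ {v = v} {f [ v ]≔ c} {f} (λ u u≢v → VecP.lookup∘update′ u≢v f c) = refl

  adj-move : ∀ f {u v} → u ≢ v → adj W (f , u) (f , v) ≡ true
  adj-move f {u} {v} u≢v rewrite dec-true (VecP.≡-dec _≟_ f f) refl | dec-false (u ≟ v) u≢v = refl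

  mustVisit-true⁻ : ∀ g f x v u → mustVisit g f x v u ≡ true → u ≢ x × u ≢ v × differs g f u ≡ true
  mustVisit-true⁻ g f x v u t =
    let u≉x , rest = ∧-true⁻ {not (does (u ≟ x))} t
        u≉v , d    = ∧-true⁻ {not (does (u ≟ v))} rest
    in not-does⇒ (u ≟ x) u≉x , not-does⇒ (u ≟ v) u≉v , d

  detours-agree : ∀ g f f' x v → AgreeOff v f f' → detours g f x v ≡ detours g f' x v
  detours-agree g f f' x v agree = sum-cong-≗ {n} (λ u → cong ⟦_⟧ (at u))
    where
    at : ∀ u → mustVisit g f x v u ≡ mustVisit g f' x v u
    at u with u ≟ v
    ... | yes refl = refl
    ... | no u≢v   = cong (λ a → not (does (u ≟ x)) ∧ true ∧ not (does (lookup g u ≟ a))) (agree u u≢v)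

  detours-self : ∀ g x v → detours g g x v ≡ 0
  detours-self g x v = trans (sum-cong-≗ {n} (λ u → cong ⟦_⟧ (at u))) (sum-replicate-zero n)
    where
    at : ∀ u → mustVisit g g x v u ≡ false
    at u rewrite dec-true (lookup g u ≟ lookup g u) refl = trans (cong (not (does (u ≟ x)) ∧_) (∧-zeroʳ _)) (∧-zeroʳ _)

  -- The vertices to visit from x back to x are those from x to v, plus v itself if it differs.
  detours-closed : ∀ g f {x v} → v ≢ x → detours g f x v + ⟦ differs g f v ⟧ ≡ detours g f x x
  detours-closed g f {x} {v} v≢x = begin
    detours g f x v + ⟦ differs g f v ⟧
      ≡⟨ cong (detours g f x v +_) (sym (∑-pick n v (λ u → ⟦ differs g f u ⟧))) ⟩
    detours g f x v + ∑[ u < n ] (⟦ does (u ≟ v) ⟧ * ⟦ differs g f u ⟧)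
      ≡⟨ sym (∑-distrib-+ (λ u → ⟦ mustVisit g f x v u ⟧) _) ⟩
    ∑[ u < n ] (⟦ mustVisit g f x v u ⟧ + ⟦ does (u ≟ v) ⟧ * ⟦ differs g f u ⟧)
      ≡⟨ sum-cong-≗ {n} at ⟩
    detours g f x x ∎
    where
    open ≡-Reasoning
    at : ∀ u → ⟦ mustVisit g f x v u ⟧ + ⟦ does (u ≟ v) ⟧ * ⟦ differs g f u ⟧ ≡ ⟦ mustVisit g f x x u ⟧
    at u with u ≟ v | u ≟ x
    ... | yes refl | yes refl = ⊥-elim (v≢x refl)
    ... | yes refl | no  _    = +-identityʳ _
    ... | no  _    | yes refl = refl
    ... | no  _    | no  _    = +-identityʳ _

  detours-from-equal : ∀ g f x v → lookup g v ≡ lookup f v → detours g f x v ≡ detours g f x x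
  detours-from-equal g f x v gv≡fv with v ≟ x
  ... | yes refl = refl
  ... | no v≢x   = begin
    detours g f x v                                            ≡⟨ +-identityʳ _ ⟨
    detours g f x v + ⟦ not true ⟧                             ≡⟨ cong (λ b → detours g f x v + ⟦ not b ⟧) (dec-true (lookup g v ≟ lookup f v) gv≡fv) ⟨
    detours g f x v + ⟦ differs g f v ⟧                        ≡⟨ detours-closed g f v≢x ⟩
    detours g f x x                                            ∎
    where open ≡-Reasoning

  detours≡0⇒agree : ∀ g f x → detours g f x x ≡ 0 → AgreeOff x g f
  detours≡0⇒agree g f x D≡0 u u≢x with ∑≡0⇒≡0 (λ w → ⟦ mustVisit g f x x w ⟧) D≡0 u
  ... | at-u rewrite dec-false (u ≟ x) u≢x with lookup g u ≟ lookup f u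
  ...   | yes gu≡fu = gu≡fu
  ...   | no  _     = ⊥-elim (1+n≢0 at-u)

  agree⇒detours≡0 : ∀ g f x → AgreeOff x g f → detours g f x x ≡ 0
  agree⇒detours≡0 g f x agree = trans (sum-cong-≗ {n} (λ u → cong ⟦_⟧ (at u))) (sum-replicate-zero n)
    where
    at : ∀ u → mustVisit g f x x u ≡ false
    at u with u ≟ x
    ... | yes _   = refl
    ... | no u≢x rewrite dec-true (lookup g u ≟ lookup f u) (agree u u≢x) = refl

  detours≤closed : ∀ g f {x v} → v ≢ x → detours g f x v ≤ detours g f x x
  detours≤closed g f v≢x = ≤-trans (m≤m+n _ _) (≤-reflexive (detours-closed g f v≢x))

  closed≤1+detours : ∀ g f {x v} → v ≢ x → detours g f x x ≤ suc (detours g f x v)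
  closed≤1+detours g f {v = v} v≢x = ≤-trans (≤-reflexive (sym (detours-closed g f v≢x)))
                                          (≤-trans (+-monoʳ-≤ _ (⟦⟧≤1 (differs g f v))) (≤-reflexive (+-comm _ 1)))

  tour-closed : ∀ g f x → tour g f x x ≡ tourLength true (detours g f x x)
  tour-closed g f x = cong (λ b → tourLength b (detours g f x x)) (dec-true (x ≟ x) refl)

  tour-open : ∀ g f {x v} → v ≢ x → tour g f x v ≡ suc (detours g f x v)
  tour-open g f {x} {v} v≢x = cong (λ b → tourLength b (detours g f x v)) (dec-false (x ≟ v) (v≢x ∘ sym))

  tour-step : ∀ g f x {v v'} → v' ≢ v → tour g f x v ≤ suc (tour g f x v')
  tour-step g f x {v} {v'} v'≢v with x ≟ v | x ≟ v'
  ... | yes refl | yes refl = ⊥-elim (v'≢v refl)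
  ... | yes refl | no  x≢v' = ≤-trans (tourLength-≤ true _) (s≤s (closed≤1+detours g f (x≢v' ∘ sym)))
  ... | no  x≢v  | yes refl = open-≤-closed (detours≤closed g f (x≢v ∘ sym))
  ... | no  x≢v  | no  x≢v' = s≤s (≤-trans (detours≤closed g f (x≢v ∘ sym)) (closed≤1+detours g f (x≢v' ∘ sym)))

  layerDistance-self : ∀ g → layerDistance g g ≡ 0
  layerDistance-self g = trans (sum-cong-≗ {n} (λ u → dH.source (lookup g u))) (sum-replicate-zero n)

  layerDistance≡0 : ∀ g f → layerDistance g f ≡ 0 → g ≡ f
  layerDistance≡0 g f L≡0 =
    lookup-ext (λ u → sym (dH.zero⇒source (lookup g u) (lookup f u) (∑≡0⇒≡0 (λ w → dH (lookup g w) (lookup f w)) L≡0 u)))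

  layerDistance-swap : ∀ g f f' v → AgreeOff v f f' →
    layerDistance g f + dH (lookup g v) (lookup f' v) ≡ layerDistance g f' + dH (lookup g v) (lookup f v)
  layerDistance-swap g f f' v agree = ∑-swap-at v _ _ (λ u u≢v → cong (dH (lookup g u)) (agree u u≢v))

  layer-step : ∀ g f' f v → AgreeOff v f' f → aH (lookup f' v) (lookup f v) ≡ true →
               layerDistance g f ≤ suc (layerDistance g f')
  layer-step g f' f v agree a = +-cancelʳ-≤ (dH (lookup g v) (lookup f' v)) _ _ (begin
    layerDistance g f + dH (lookup g v) (lookup f' v)         ≡⟨ layerDistance-swap g f f' v (λ u u≢v → sym (agree u u≢v)) ⟩
    layerDistance g f' + dH (lookup g v) (lookup f v)         ≤⟨ +-monoʳ-≤ _ (dH.edge-≤ (lookup g v) (lookup f' v) (lookup f v) a) ⟩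
    layerDistance g f' + suc (dH (lookup g v) (lookup f' v))  ≡⟨ +-suc _ _ ⟩
    suc (layerDistance g f') + dH (lookup g v) (lookup f' v)  ∎)
    where open ≤-Reasoning

  wreathDistance-edge : ∀ g x z y → adj W z y ≡ true → wreathDistance g x y ≤ suc (wreathDistance g x z)
  wreathDistance-edge g x (f' , v') (f , v) a with adj-cases {f'} {v'} {f} {v} a
  ... | inj₁ (refl , agree , a') = begin
    layerDistance g f + tour g f x v'          ≤⟨ +-monoˡ-≤ _ (layer-step g f' f v' agree a') ⟩
    suc (layerDistance g f') + tour g f x v'   ≡⟨ cong (λ D → suc (layerDistance g f') + tourLength (does (x ≟ v')) D) (detours-agree g f' f x v' agree) ⟨
    suc (layerDistance g f' + tour g f' x v')  ∎
    where open ≤-Reasoning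
  ... | inj₂ (refl , v'≢v) = ≤-trans (+-monoʳ-≤ (layerDistance g f) (tour-step g f x v'≢v)) (≤-reflexive (+-suc _ _))

  descent-layer : ∀ g x f v k j → wreathDistance g x (f , v) ≡ suc k → dH (lookup g v) (lookup f v) ≡ suc j →
                  ∃ λ z → adj W z (f , v) ≡ true × wreathDistance g x z ≡ k
  descent-layer g x f v k j Ψ≡1+k d≡1+j with dH.descent (lookup g v) j (lookup f v) d≡1+j
  ... | c , c~fv , dc≡j = (f' , v) , adj-layer f v c c~fv , suc-injective (begin
    suc (layerDistance g f') + tour g f' x v  ≡⟨ cong (λ D → suc (layerDistance g f') + tourLength (does (x ≟ v)) D) (detours-agree g f' f x v agree) ⟩
    suc (layerDistance g f') + tour g f x v   ≡⟨ cong (_+ tour g f x v) layer ⟨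
    wreathDistance g x (f , v)                ≡⟨ Ψ≡1+k ⟩
    suc k                                     ∎)
    where
    open ≡-Reasoning
    f' = f [ v ]≔ c
    agree : AgreeOff v f' f
    agree u u≢v = VecP.lookup∘update′ u≢v f c
    layer : layerDistance g f ≡ suc (layerDistance g f')
    layer = +-cancelʳ-≡ j _ _ (begin
      layerDistance g f + j                              ≡⟨ cong (layerDistance g f +_) (trans (cong (dH (lookup g v)) (VecP.lookup∘update v f c)) dc≡j) ⟨
      layerDistance g f + dH (lookup g v) (lookup f' v)  ≡⟨ layerDistance-swap g f' f v agree ⟨
      layerDistance g f' + dH (lookup g v) (lookup f v)  ≡⟨ trans (cong (layerDistance g f' +_) d≡1+j) (+-suc _ j) ⟩
      suc (layerDistance g f') + j                       ∎)

  wreathDistance-source : ∀ g x → wreathDistance g x (g , x) ≡ 0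
  wreathDistance-source g x = cong₂ _+_ (layerDistance-self g) (trans (tour-closed g g x) (cong (tourLength true) (detours-self g x x)))

  detours≡0⇒≡ : ∀ g f x → lookup g x ≡ lookup f x → detours g f x x ≡ 0 → g ≡ f
  detours≡0⇒≡ g f x gx≡fx D≡0 = lookup-ext agree
    where
    agree : ∀ u → lookup g u ≡ lookup f u
    agree u with u ≟ x
    ... | yes refl = gx≡fx
    ... | no  u≢x  = detours≡0⇒agree g f x D≡0 u u≢x

  -- Going to u first removes u from the vertices still to be visited, and v is not among them.
  descent-visit : ∀ g x f v k u → wreathDistance g x (f , v) ≡ suc k → lookup g v ≡ lookup f v →
                  mustVisit g f x v u ≡ true → wreathDistance g x (f , u) ≡ k
  descent-visit g x f v k u Ψ≡1+k gv≡fv visit = suc-injective (begin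
    suc (layerDistance g f + tour g f x u)             ≡⟨ +-suc _ _ ⟨
    layerDistance g f + suc (tour g f x u)             ≡⟨ cong (λ t → layerDistance g f + suc t) (tour-open g f u≢x) ⟩
    layerDistance g f + suc (suc d)                    ≡⟨ cong (layerDistance g f +_) (tourLength-suc (does (x ≟ v)) d) ⟨
    layerDistance g f + tourLength (does (x ≟ v)) (suc d) ≡⟨ cong (λ D → layerDistance g f + tourLength (does (x ≟ v)) D) detours-v ⟨
    wreathDistance g x (f , v)                         ≡⟨ Ψ≡1+k ⟩
    suc k                                              ∎)
    where
    open ≡-Reasoning
    u≢x : u ≢ x
    u≢x = proj₁ (mustVisit-true⁻ g f x v u visit)
    d : ℕ
    d = detours g f x u
    detours-v : detours g f x v ≡ suc d
    detours-v = begin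
      detours g f x v                      ≡⟨ detours-from-equal g f x v gv≡fv ⟩
      detours g f x x                      ≡⟨ detours-closed g f u≢x ⟨
      d + ⟦ differs g f u ⟧                ≡⟨ cong (λ b → d + ⟦ b ⟧) (proj₂ (proj₂ (mustVisit-true⁻ g f x v u visit))) ⟩
      d + 1                                ≡⟨ +-comm d 1 ⟩
      suc d                                ∎

  descent-return : ∀ g x f v k → wreathDistance g x (f , v) ≡ suc k → lookup g v ≡ lookup f v →
                   detours g f x v ≡ 0 → x ≢ v → wreathDistance g x (f , x) ≡ k
  descent-return g x f v k Ψ≡1+k gv≡fv D≡0 x≢v = +-cancelʳ-≡ 1 _ _ (begin
    layerDistance g f + tour g f x x + 1          ≡⟨ cong (λ t → layerDistance g f + t + 1) tour-x ⟩
    layerDistance g f + 0 + 1                     ≡⟨ cong (_+ 1) (+-identityʳ _) ⟩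
    layerDistance g f + 1                         ≡⟨ cong (layerDistance g f +_) (trans (tour-open g f (x≢v ∘ sym)) (cong suc D≡0)) ⟨
    wreathDistance g x (f , v)                    ≡⟨ trans Ψ≡1+k (+-comm 1 k) ⟩
    k + 1                                         ∎)
    where
    open ≡-Reasoning
    tour-x : tour g f x x ≡ 0
    tour-x = trans (tour-closed g f x) (cong (tourLength true) (trans (sym (detours-from-equal g f x v gv≡fv)) D≡0))

  descent-tour : ∀ g x f v k → wreathDistance g x (f , v) ≡ suc k → lookup g v ≡ lookup f v →
                 ∃ λ z → adj W z (f , v) ≡ true × wreathDistance g x z ≡ k
  descent-tour g x f v k Ψ≡1+k gv≡fv = cases (detours g f x v) refl (x ≟ v)
    where
    cases : ∀ D → detours g f x v ≡ D → Dec (x ≡ v) → ∃ λ z → adj W z (f , v) ≡ true × wreathDistance g x z ≡ k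
    cases (suc c) D≡1+c _ =
      let u , visit≢0 = ∑≢0⇒∃≢0 (λ u → ⟦ mustVisit g f x v u ⟧) c D≡1+c
          visit       = ⟦⟧≢0⇒ visit≢0
      in (f , u) , adj-move f (proj₁ (proj₂ (mustVisit-true⁻ g f x v u visit))) , descent-visit g x f v k u Ψ≡1+k gv≡fv visit
    cases zero D≡0 (yes refl) =
      ⊥-elim (1+n≢0 (trans (sym Ψ≡1+k) (trans (cong (λ f' → wreathDistance g x (f' , x)) (sym (detours≡0⇒≡ g f x gv≡fv D≡0)))
                                             (wreathDistance-source g x))))
    cases zero D≡0 (no x≢v) = (f , x) , adj-move f x≢v , descent-return g x f v k Ψ≡1+k gv≡fv D≡0 x≢v

  isDistanceFrom-wreathDistance : ∀ g x → IsDistanceFrom W (g , x) (wreathDistance g x)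
  isDistanceFrom-wreathDistance g x = record
    { source      = wreathDistance-source g x
    ; zero⇒source = zero⇒source
    ; edge-≤      = wreathDistance-edge g x
    ; descent     = descent
    }
    where
    zero⇒source : ∀ y → wreathDistance g x y ≡ 0 → y ≡ (g , x)
    zero⇒source (f , v) Ψ≡0 = cong₂ _,_ (sym (layerDistance≡0 g f (m+n≡0⇒m≡0 _ Ψ≡0))) (sym (tour≡0 (x ≟ v) (m+n≡0⇒n≡0 _ Ψ≡0)))
      where
      tour≡0 : ∀ (x≟v : Dec (x ≡ v)) → tourLength (does x≟v) (detours g f x v) ≡ 0 → x ≡ v
      tour≡0 (yes x≡v) _ = x≡v
      tour≡0 (no  _)   ()
    descent : ∀ k y → wreathDistance g x y ≡ suc k → ∃ λ z → adj W z y ≡ true × wreathDistance g x z ≡ k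
    descent k (f , v) Ψ≡1+k = cases (dH (lookup g v) (lookup f v)) refl
      where
      cases : ∀ d → dH (lookup g v) (lookup f v) ≡ d → ∃ λ z → adj W z (f , v) ≡ true × wreathDistance g x z ≡ k
      cases (suc j) d≡1+j = descent-layer g x f v k j Ψ≡1+k d≡1+j
      cases zero    d≡0   = descent-tour g x f v k Ψ≡1+k (sym (dH.zero⇒source (lookup g v) (lookup f v) d≡0))

  dist-wreath : ∀ g x y → dist W (g , x) y ≡ wreathDistance g x y
  dist-wreath g x = DistanceFrom.dist≡label W verts-complete (g , x) (isDistanceFrom-wreathDistance g x)

  nVert-wreath : ∀ y z → nVert W y z ≡ ∑[ g ∈ allVecs n m ] ∑[ x < n ] ⟦ wreathDistance g x y <ᵇ wreathDistance g x z ⟧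
  nVert-wreath y z = begin
    nVert W y z
      ≡⟨ length-filterᵇ _ (verts W) ⟩
    ∑[ w ∈ verts W ] ⟦ dist W w y <ᵇ dist W w z ⟧
      ≡⟨ ∑-cartesianProduct (allVecs n m) (allFin n) _ ⟩
    ∑[ g ∈ allVecs n m ] ∑[ x ∈ allFin n ] ⟦ dist W (g , x) y <ᵇ dist W (g , x) z ⟧
      ≡⟨ ∑-list-cong (allVecs n m) (λ g → trans (∑-allFin n _) (sum-cong-≗ {n} λ x →
           cong₂ (λ s t → ⟦ s <ᵇ t ⟧) (dist-wreath g x y) (dist-wreath g x z))) ⟩
    ∑[ g ∈ allVecs n m ] ∑[ x < n ] ⟦ wreathDistance g x y <ᵇ wreathDistance g x z ⟧ ∎
    where open ≡-Reasoning

  nVert-H : ∀ a b → nVert H a b ≡ ∑[ c < m ] ⟦ dH c a <ᵇ dH c b ⟧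
  nVert-H a b = trans (length-filterᵇ _ (allFin m)) (∑-allFin m _)

  compare-layer : ∀ g x f f' v → AgreeOff v f f' →
    (wreathDistance g x (f , v) <ᵇ wreathDistance g x (f' , v)) ≡ (dH (lookup g v) (lookup f v) <ᵇ dH (lookup g v) (lookup f' v))
  compare-layer g x f f' v agree = begin
    (layerDistance g f + tour g f x v <ᵇ layerDistance g f' + tour g f' x v)
      ≡⟨ cong (λ D → layerDistance g f + tour g f x v <ᵇ layerDistance g f' + tourLength (does (x ≟ v)) D) (detours-agree g f f' x v agree) ⟨
    (layerDistance g f + tour g f x v <ᵇ layerDistance g f' + tour g f x v)
      ≡⟨ <ᵇ-cancelʳ (tour g f x v) (layerDistance g f) (layerDistance g f') ⟩
    (layerDistance g f <ᵇ layerDistance g f')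
      ≡⟨ <ᵇ-exchange {layerDistance g f} {layerDistance g f'} (layerDistance-swap g f f' v agree) ⟩
    (dH (lookup g v) (lookup f v) <ᵇ dH (lookup g v) (lookup f' v)) ∎
    where open ≡-Reasoning

  compare-move : ∀ g x f v v' → (wreathDistance g x (f , v) <ᵇ wreathDistance g x (f , v')) ≡ (tour g f x v <ᵇ tour g f x v')
  compare-move g x f v v' = <ᵇ-cancelˡ (layerDistance g f) (tour g f x v) (tour g f x v')

  compare-from-source : ∀ g f {v v'} → v' ≢ v → (tour g f v v <ᵇ tour g f v v') ≡ agreesOffᵇ v f g
  compare-from-source g f {v} {v'} v'≢v = begin
    (tour g f v v <ᵇ tour g f v v')
      ≡⟨ cong₂ _<ᵇ_ (tour-closed g f v) (tour-open g f v'≢v) ⟩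
    (tourLength true (detours g f v v) <ᵇ suc (detours g f v v'))
      ≡⟨ does-≡ (tourLength true (detours g f v v) <? suc (detours g f v v')) to from ⟩
    agreesOffᵇ v f g ∎
    where
    open ≡-Reasoning
    to : tourLength true (detours g f v v) < suc (detours g f v v') → agreesOffᵇ v f g ≡ true
    to lt = agreesOffᵇ⇐ {f = f} {g} (λ u u≢v → sym (detours≡0⇒agree g f v (closed<open⇒≡0 (detours≤closed g f v'≢v) lt) u u≢v))
    from : agreesOffᵇ v f g ≡ true → tourLength true (detours g f v v) < suc (detours g f v v')
    from agree rewrite agree⇒detours≡0 g f v (λ u u≢v → sym (agreesOffᵇ⇒ {f = f} {g} agree u u≢v)) = s≤s z≤n

  compare-from-target : ∀ g f {v v'} → v ≢ v' → (tour g f v' v <ᵇ tour g f v' v') ≡ differs g f v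
  compare-from-target g f {v} {v'} v≢v' = begin
    (tour g f v' v <ᵇ tour g f v' v')
      ≡⟨ cong₂ _<ᵇ_ (tour-open g f v≢v') (tour-closed g f v') ⟩
    (suc (detours g f v' v) <ᵇ tourLength true (detours g f v' v'))
      ≡⟨ cong (λ c → suc (detours g f v' v) <ᵇ tourLength true c) (detours-closed g f v≢v') ⟨
    (suc (detours g f v' v) <ᵇ tourLength true (detours g f v' v + ⟦ differs g f v ⟧))
      ≡⟨ open<closed (detours g f v' v) (differs g f v) ⟩
    differs g f v ∎
    where open ≡-Reasoning

  compare-elsewhere : ∀ g f {x v v'} → v ≢ x → v' ≢ x →
                      (tour g f x v <ᵇ tour g f x v') ≡ differs g f v ∧ not (differs g f v')
  compare-elsewhere g f {x} {v} {v'} v≢x v'≢x = begin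
    (tour g f x v <ᵇ tour g f x v')
      ≡⟨ cong₂ _<ᵇ_ (tour-open g f v≢x) (tour-open g f v'≢x) ⟩
    (suc (detours g f x v) <ᵇ suc (detours g f x v'))
      ≡⟨ open<open (differs g f v) (differs g f v') (trans (detours-closed g f v≢x) (sym (detours-closed g f v'≢x))) ⟩
    differs g f v ∧ not (differs g f v') ∎
    where open ≡-Reasoning

moveCount-closed-form : ∀ j m → m + ((m ∸ 1) * m ^ suc j + j * ((m ∸ 1) * (1 * m ^ j)))
                              ≡ m + m ^ j * (m * m + m * suc (suc j) + 2 ∸ (3 * m + suc (suc j)))
moveCount-closed-form j zero rewrite 0∸n≡0 j | *-zeroʳ (0 ^ j) = *-zeroʳ j
moveCount-closed-form j (suc k) = begin
  suc k + (k * (suc k * q) + j * (k * (1 * q)))   ≡⟨ regroup k j q ⟩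
  suc k + q * (k * (suc k + j))                   ≡⟨ cong (λ t → suc k + q * t) (m+n∸m≡n (3 * suc k + suc (suc j)) _) ⟨
  suc k + q * (3 * suc k + suc (suc j) + k * (suc k + j) ∸ (3 * suc k + suc (suc j)))
    ≡⟨ cong (λ t → suc k + q * (t ∸ (3 * suc k + suc (suc j)))) (expand k j) ⟨
  suc k + q * (suc k * suc k + suc k * suc (suc j) + 2 ∸ (3 * suc k + suc (suc j))) ∎
  where
  open ≡-Reasoning
  q : ℕ
  q = suc k ^ j
  regroup : ∀ k j q → suc k + (k * (suc k * q) + j * (k * (1 * q))) ≡ suc k + q * (k * (suc k + j))
  regroup = solve-∀
  expand : ∀ k j → suc k * suc k + suc k * suc (suc j) + 2 ≡ 3 * suc k + suc (suc j) + k * (suc k + j)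
  expand = solve-∀

module WreathCounts (j : ℕ) {m} (aH : Adj m) (connected : IsConnected aH) where
  open Wreath {suc (suc j)} {m} aH connected

  private
    n : ℕ
    n = suc (suc j)

  nVert-layer : ∀ f f' v → AgreeOff v f f' →
                nVert W (f , v) (f' , v) ≡ n * (nVert H (lookup f v) (lookup f' v) * m ^ suc j)
  nVert-layer f f' v agree = begin
    nVert W (f , v) (f' , v)
      ≡⟨ nVert-wreath _ _ ⟩
    ∑[ g ∈ allVecs n m ] ∑[ x < n ] ⟦ wreathDistance g x (f , v) <ᵇ wreathDistance g x (f' , v) ⟧
      ≡⟨ ∑-list-cong (allVecs n m) (λ g →
           trans (sum-cong-≗ {n} (λ x → cong ⟦_⟧ (compare-layer g x f f' v agree))) (∑-const n (φ (lookup g v)))) ⟩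
    ∑[ g ∈ allVecs n m ] (n * φ (lookup g v))
      ≡⟨ *-distribˡ-∑-list (allVecs n m) n _ ⟨
    n * ∑[ g ∈ allVecs n m ] φ (lookup g v)
      ≡⟨ cong (n *_) (∑-allVecs-coord m v φ) ⟩
    n * (sum φ * m ^ suc j)
      ≡⟨ cong (λ t → n * (t * m ^ suc j)) (nVert-H (lookup f v) (lookup f' v)) ⟨
    n * (nVert H (lookup f v) (lookup f' v) * m ^ suc j) ∎
    where
    open ≡-Reasoning
    φ : Fin m → ℕ
    φ c = ⟦ dH c (lookup f v) <ᵇ dH c (lookup f' v) ⟧

  moveCount : ℕ
  moveCount = m + ((m ∸ 1) * m ^ suc j + j * ((m ∸ 1) * (1 * m ^ j)))

  moveCount-≡ : moveCount ≡ m + m ^ j * (m * m + m * n + 2 ∸ (3 * m + n))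
  moveCount-≡ = moveCount-closed-form j m

  nVert-move : ∀ f {v v'} → v ≢ v' → nVert W (f , v) (f , v') ≡ moveCount
  nVert-move f {v} {v'} v≢v' = begin
    nVert W (f , v) (f , v')
      ≡⟨ nVert-wreath _ _ ⟩
    ∑[ g ∈ allVecs n m ] ∑[ x < n ] ⟦ wreathDistance g x (f , v) <ᵇ wreathDistance g x (f , v') ⟧
      ≡⟨ ∑-list-sum-comm (allVecs n m) n (λ g x → ⟦ wreathDistance g x (f , v) <ᵇ wreathDistance g x (f , v') ⟧) ⟩
    ∑[ x < n ] F x
      ≡⟨ ∑-except₂ F ((m ∸ 1) * (1 * m ^ j)) v≢v' elsewhere ⟩
    F v + (F v' + j * ((m ∸ 1) * (1 * m ^ j)))
      ≡⟨ cong₂ (λ a b → a + (b + j * ((m ∸ 1) * (1 * m ^ j)))) from-source from-target ⟩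
    moveCount ∎
    where
    open ≡-Reasoning
    F : Fin n → ℕ
    F x = ∑[ g ∈ allVecs n m ] ⟦ wreathDistance g x (f , v) <ᵇ wreathDistance g x (f , v') ⟧
    compare : ∀ x {b : Config → Bool} → (∀ g → (tour g f x v <ᵇ tour g f x v') ≡ b g) → F x ≡ ∑[ g ∈ allVecs n m ] ⟦ b g ⟧
    compare x tour≡b = ∑-list-cong (allVecs n m) (λ g → cong ⟦_⟧ (trans (compare-move g x f v v') (tour≡b g)))
    from-source : F v ≡ m
    from-source = begin
      F v                                                  ≡⟨ compare v (λ g → compare-from-source g f (v≢v' ∘ sym)) ⟩
      ∑[ g ∈ allVecs n m ] ⟦ agreesOffᵇ v f g ⟧            ≡⟨ ∑-list-cong (allVecs n m) (λ g → *-identityʳ _) ⟨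
      ∑[ g ∈ allVecs n m ] (⟦ agreesOffᵇ v f g ⟧ * 1)      ≡⟨ ∑-allVecs-agreesOff v f (λ _ → 1) ⟩
      ∑[ a < m ] 1                                         ≡⟨ trans (∑-const m 1) (*-identityʳ m) ⟩
      m                                                    ∎
    from-target : F v' ≡ (m ∸ 1) * m ^ suc j
    from-target = begin
      F v'                                                 ≡⟨ compare v' (λ g → compare-from-target g f v≢v') ⟩
      ∑[ g ∈ allVecs n m ] ⟦ differs g f v ⟧               ≡⟨ ∑-allVecs-coord m v (λ a → ⟦ not (does (a ≟ lookup f v)) ⟧) ⟩
      ∑[ a < m ] ⟦ not (does (a ≟ lookup f v)) ⟧ * m ^ suc j ≡⟨ cong (_* m ^ suc j) (∑-≢ m (lookup f v)) ⟩
      (m ∸ 1) * m ^ suc j                                  ∎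
    elsewhere : ∀ x → x ≢ v → x ≢ v' → F x ≡ (m ∸ 1) * (1 * m ^ j)
    elsewhere x x≢v x≢v' = begin
      F x
        ≡⟨ compare x (λ g → compare-elsewhere g f (x≢v ∘ sym) (x≢v' ∘ sym)) ⟩
      ∑[ g ∈ allVecs n m ] ⟦ differs g f v ∧ not (differs g f v') ⟧
        ≡⟨ ∑-list-cong (allVecs n m) (λ g → ⟦∧⟧ (differs g f v) (not (differs g f v'))) ⟩
      ∑[ g ∈ allVecs n m ] (⟦ not (does (lookup g v ≟ lookup f v)) ⟧ * ⟦ not (not (does (lookup g v' ≟ lookup f v'))) ⟧)
        ≡⟨ ∑-allVecs-coord₂ m (λ a → ⟦ not (does (a ≟ lookup f v)) ⟧) (λ a → ⟦ not (not (does (a ≟ lookup f v'))) ⟧) v≢v' ⟩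
      ∑[ a < m ] ⟦ not (does (a ≟ lookup f v)) ⟧ * (∑[ a < m ] ⟦ not (not (does (a ≟ lookup f v'))) ⟧ * m ^ j)
        ≡⟨ cong₂ (λ s t → s * (t * m ^ j)) (∑-≢ m (lookup f v))
                 (trans (sum-cong-≗ {m} (λ a → cong ⟦_⟧ (not-involutive _))) (∑-indicator m (lookup f v'))) ⟩
      (m ∸ 1) * (1 * m ^ j) ∎

-- The Szeged index as a sum over ordered pairs of adjacent vertices

sum-map : ∀ {A : Set} (f : A → ℕ) xs → ListAction.sum (map f xs) ≡ ∑-list xs f
sum-map f []       = refl
sum-map f (x ∷ xs) = cong (f x +_) (sum-map f xs)

module _ (X : Graph) (adj-sym : ∀ u v → adj X u v ≡ adj X v u) (adj-irrefl : ∀ u → adj X u u ≡ false) where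

  twice-∑-edgesOf : ∀ (h : V X → V X → ℕ) → (∀ u v → h u v ≡ h v u) → ∀ xs →
    2 * ∑[ e ∈ edgesOf X xs ] h (proj₁ e) (proj₂ e) ≡ ∑[ u ∈ xs ] ∑[ v ∈ xs ] (⟦ adj X u v ⟧ * h u v)
  twice-∑-edgesOf h h-sym []       = refl
  twice-∑-edgesOf h h-sym (x ∷ xs) = begin
    2 * ∑-list (map (x ,_) (filterᵇ (adj X x) xs) ++ edgesOf X xs) H
      ≡⟨ cong (2 *_) (∑-list-++ (map (x ,_) (filterᵇ (adj X x) xs)) (edgesOf X xs) H) ⟩
    2 * (∑-list (map (x ,_) (filterᵇ (adj X x) xs)) H + ∑-list (edgesOf X xs) H)
      ≡⟨ cong (λ t → 2 * (t + ∑-list (edgesOf X xs) H)) (trans (∑-list-map (x ,_) (filterᵇ (adj X x) xs) H) (∑-filterᵇ (adj X x) xs (h x))) ⟩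
    2 * (P + ∑-list (edgesOf X xs) H)
      ≡⟨ *-distribˡ-+ 2 P _ ⟩
    2 * P + 2 * ∑-list (edgesOf X xs) H
      ≡⟨ cong (2 * P +_) (twice-∑-edgesOf h h-sym xs) ⟩
    2 * P + R
      ≡⟨ double P R ⟩
    P + (P + R)
      ≡⟨ cong₂ (λ b t → ⟦ b ⟧ * h x x + P + (t + R)) (sym (adj-irrefl x))
               (∑-list-cong xs (λ u → cong₂ (λ b c → ⟦ b ⟧ * c) (adj-sym x u) (h-sym x u))) ⟩
    ⟦ adj X x x ⟧ * h x x + P + (∑[ u ∈ xs ] (⟦ adj X u x ⟧ * h u x) + R)
      ≡⟨ cong (⟦ adj X x x ⟧ * h x x + P +_) (∑-list-distrib-+ xs _ _) ⟨
    ∑[ u ∈ x ∷ xs ] ∑[ v ∈ x ∷ xs ] (⟦ adj X u v ⟧ * h u v) ∎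
    where
    open ≡-Reasoning
    H : V X × V X → ℕ
    H e = h (proj₁ e) (proj₂ e)
    P R : ℕ
    P = ∑[ v ∈ xs ] (⟦ adj X x v ⟧ * h x v)
    R = ∑[ u ∈ xs ] ∑[ v ∈ xs ] (⟦ adj X u v ⟧ * h u v)
    double : ∀ a b → 2 * a + b ≡ a + (a + b)
    double = solve-∀

  twice-Sz : 2 * Sz X ≡ ∑[ u ∈ verts X ] ∑[ v ∈ verts X ] (⟦ adj X u v ⟧ * (nVert X u v * nVert X v u))
  twice-Sz = trans (cong (2 *_) (sum-map _ (edgesOf X (verts X))))
                   (twice-∑-edgesOf (λ u v → nVert X u v * nVert X v u) (λ u v → *-comm (nVert X u v) _) (verts X))

-- The Szeged index of Kₙ ≀ H

⟦∨-disjoint⟧ : ∀ a x y → ⟦ (a ∧ x) ∨ (y ∧ not a) ⟧ ≡ ⟦ a ∧ x ⟧ + ⟦ y ∧ not a ⟧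
⟦∨-disjoint⟧ true  true  true  = refl
⟦∨-disjoint⟧ true  true  false = refl
⟦∨-disjoint⟧ true  false true  = refl
⟦∨-disjoint⟧ true  false false = refl
⟦∨-disjoint⟧ false x     y     = refl

module WreathSzeged (j : ℕ) {m} (aH : Adj m) (simple : IsSimple aH) (connected : IsConnected aH) where
  open Wreath {suc (suc j)} {m} aH connected
  open WreathCounts j aH connected

  private
    n : ℕ
    n = suc (suc j)

  agreesOffᵇ-sym : ∀ v f f' → agreesOffᵇ v f f' ≡ agreesOffᵇ {n} {m} v f' f
  agreesOffᵇ-sym v f f' = all-cong (allFin n) (λ w → cong (does (w ≟ v) ∨_) (does-sym (lookup f w) (lookup f' w)))

  adj-wreath-sym : ∀ y z → adj W y z ≡ adj W z y
  adj-wreath-sym (f , v) (f' , v') with v ≟ v' | v' ≟ v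
  ... | yes refl | yes _    rewrite agreesOffᵇ-sym v f f' | proj₁ simple (lookup f v) (lookup f' v)
                                  | does-⇔ (mk⇔ sym sym) (VecP.≡-dec _≟_ f f') (VecP.≡-dec _≟_ f' f) = refl
  ... | yes refl | no  v≢v  = ⊥-elim (v≢v refl)
  ... | no  v≢v' | yes refl = ⊥-elim (v≢v' refl)
  ... | no  _    | no  _    rewrite does-⇔ (mk⇔ sym sym) (VecP.≡-dec _≟_ f f') (VecP.≡-dec _≟_ f' f) = refl

  adj-wreath-irrefl : ∀ y → adj W y y ≡ false
  adj-wreath-irrefl (f , v) rewrite dec-true (v ≟ v) refl | proj₂ simple (lookup f v) | dec-true (VecP.≡-dec _≟_ f f) refl
    = cong (_∨ false) (∧-zeroʳ (agreesOffᵇ v f f))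

  weight : Config × Fin n → Config × Fin n → ℕ
  weight y z = nVert W y z * nVert W z y

  layerWeight : Fin m → Fin m → ℕ
  layerWeight a c = (n * (nVert H a c * m ^ suc j)) * (n * (nVert H c a * m ^ suc j))

  layerAdj moveAdj : Config → Fin n → Config × Fin n → Bool
  layerAdj f v (f' , v') = does (v ≟ v') ∧ (agreesOffᵇ v f f' ∧ aH (lookup f v) (lookup f' v))
  moveAdj  f v (f' , v') = does (VecP.≡-dec _≟_ f f') ∧ not (does (v ≟ v'))

  layer-edges : ∀ f v → ∑[ z ∈ verts W ] (⟦ layerAdj f v z ⟧ * weight (f , v) z)
                      ≡ ∑[ c < m ] (⟦ aH (lookup f v) c ⟧ * layerWeight (lookup f v) c)
  layer-edges f v = begin
    ∑[ z ∈ verts W ] (⟦ layerAdj f v z ⟧ * weight (f , v) z)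
      ≡⟨ ∑-cartesianProduct (allVecs n m) (allFin n) _ ⟩
    ∑[ f' ∈ allVecs n m ] ∑[ v' ∈ allFin n ] (⟦ layerAdj f v (f' , v') ⟧ * weight (f , v) (f' , v'))
      ≡⟨ ∑-list-cong (allVecs n m) (λ f' →
           trans (∑-allFin n (λ v' → ⟦ layerAdj f v (f' , v') ⟧ * weight (f , v) (f' , v'))) (same-coordinate f')) ⟩
    ∑[ f' ∈ allVecs n m ] (⟦ edge f' ⟧ * weight (f , v) (f' , v))
      ≡⟨ ∑-list-cong (allVecs n m) layer-weight ⟩
    ∑[ f' ∈ allVecs n m ] (⟦ agreesOffᵇ v f f' ⟧ * G (lookup f' v))
      ≡⟨ ∑-allVecs-agreesOff v f G ⟩
    sum G ∎
    where
    open ≡-Reasoning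
    edge : Config → Bool
    edge f' = agreesOffᵇ v f f' ∧ aH (lookup f v) (lookup f' v)
    G : Fin m → ℕ
    G c = ⟦ aH (lookup f v) c ⟧ * layerWeight (lookup f v) c
    same-coordinate : ∀ f' → ∑[ v' < n ] (⟦ layerAdj f v (f' , v') ⟧ * weight (f , v) (f' , v')) ≡ ⟦ edge f' ⟧ * weight (f , v) (f' , v)
    same-coordinate f' = trans (sum-cong-≗ {n} pointwise) (∑-pick n v (λ v' → ⟦ edge f' ⟧ * weight (f , v) (f' , v')))
      where
      pointwise : ∀ v' → ⟦ layerAdj f v (f' , v') ⟧ * weight (f , v) (f' , v') ≡ ⟦ does (v' ≟ v) ⟧ * (⟦ edge f' ⟧ * weight (f , v) (f' , v'))
      pointwise v' = trans (cong (_* weight (f , v) (f' , v')) (⟦∧⟧ (does (v ≟ v')) (edge f')))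
                           (trans (*-assoc ⟦ does (v ≟ v') ⟧ ⟦ edge f' ⟧ _)
                                  (cong (λ b → ⟦ b ⟧ * (⟦ edge f' ⟧ * weight (f , v) (f' , v'))) (does-sym v v')))
    layer-weight : ∀ f' → ⟦ edge f' ⟧ * weight (f , v) (f' , v) ≡ ⟦ agreesOffᵇ v f f' ⟧ * G (lookup f' v)
    layer-weight f' with agreesOffᵇ v f f' in agree
    ... | false = refl
    ... | true  = trans (cong (⟦ aH (lookup f v) (lookup f' v) ⟧ *_) (cong₂ _*_
                    (nVert-layer f f' v (agreesOffᵇ⇒ {f = f} {f'} agree))
                    (nVert-layer f' f v (λ u u≢v → sym (agreesOffᵇ⇒ {f = f} {f'} agree u u≢v)))))
                  (sym (+-identityʳ _))

  move-edges : ∀ f v → ∑[ z ∈ verts W ] (⟦ moveAdj f v z ⟧ * weight (f , v) z) ≡ suc j * (moveCount * moveCount)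
  move-edges f v = begin
    ∑[ z ∈ verts W ] (⟦ moveAdj f v z ⟧ * weight (f , v) z)
      ≡⟨ ∑-cartesianProduct (allVecs n m) (allFin n) _ ⟩
    ∑[ f' ∈ allVecs n m ] ∑[ v' ∈ allFin n ] (⟦ moveAdj f v (f' , v') ⟧ * weight (f , v) (f' , v'))
      ≡⟨ ∑-list-cong (allVecs n m) (λ f' →
           trans (∑-allFin n (λ v' → ⟦ moveAdj f v (f' , v') ⟧ * weight (f , v) (f' , v'))) (sum-cong-≗ {n} (pointwise f'))) ⟩
    ∑[ f' ∈ allVecs n m ] ∑[ v' < n ] (⟦ does (VecP.≡-dec _≟_ f f') ⟧ * (⟦ not (does (v ≟ v')) ⟧ * C))
      ≡⟨ ∑-list-cong (allVecs n m) (λ f' →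
           trans (sym (*-distribˡ-sum {n} ⟦ does (VecP.≡-dec _≟_ f f') ⟧ (λ v' → ⟦ not (does (v ≟ v')) ⟧ * C)))
                 (cong (⟦ does (VecP.≡-dec _≟_ f f') ⟧ *_) others)) ⟩
    ∑[ f' ∈ allVecs n m ] (⟦ does (VecP.≡-dec _≟_ f f') ⟧ * (suc j * C))
      ≡⟨ *-distribʳ-∑-list (allVecs n m) _ _ ⟨
    ∑[ f' ∈ allVecs n m ] ⟦ does (VecP.≡-dec _≟_ f f') ⟧ * (suc j * C)
      ≡⟨ trans (cong (_* (suc j * C)) (∑-allVecs-≡ n m f)) (*-identityˡ _) ⟩
    suc j * C ∎
    where
    open ≡-Reasoning
    C : ℕ
    C = moveCount * moveCount
    pointwise : ∀ f' v' → ⟦ moveAdj f v (f' , v') ⟧ * weight (f , v) (f' , v')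
                       ≡ ⟦ does (VecP.≡-dec _≟_ f f') ⟧ * (⟦ not (does (v ≟ v')) ⟧ * C)
    pointwise f' v' with VecP.≡-dec _≟_ f f' | v ≟ v'
    ... | no  _    | _        = refl
    ... | yes refl | yes refl = refl
    ... | yes refl | no v≢v'  = cong (_+ 0) (trans (cong₂ _*_ (nVert-move f v≢v') (nVert-move f (v≢v' ∘ sym))) (sym (+-identityʳ C)))
    others : ∑[ v' < n ] (⟦ not (does (v ≟ v')) ⟧ * C) ≡ suc j * C
    others = trans (sym (*-distribʳ-sum {n} C (λ v' → ⟦ not (does (v ≟ v')) ⟧)))
                   (cong (_* C) (trans (sum-cong-≗ {n} (λ v' → cong (λ b → ⟦ not b ⟧) (does-sym v v'))) (∑-≢ n v)))

  twice-Sz-H : 2 * Sz H ≡ ∑[ a < m ] ∑[ c < m ] (⟦ aH a c ⟧ * (nVert H a c * nVert H c a))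
  twice-Sz-H = trans (twice-Sz H (proj₁ simple) (proj₂ simple))
                     (trans (∑-allFin m _) (sum-cong-≗ {m} (λ a → ∑-allFin m (λ c → ⟦ aH a c ⟧ * (nVert H a c * nVert H c a)))))

  layer-total : ∑[ a < m ] ∑[ c < m ] (⟦ aH a c ⟧ * layerWeight a c) ≡ (n * m ^ suc j) * (n * m ^ suc j) * (2 * Sz H)
  layer-total = begin
    ∑[ a < m ] ∑[ c < m ] (⟦ aH a c ⟧ * layerWeight a c)
      ≡⟨ sum-cong-≗ {m} (λ a → trans (sum-cong-≗ {m} (λ c → regroup ⟦ aH a c ⟧ n (nVert H a c) (nVert H c a) (m ^ suc j)))
                                     (sym (*-distribˡ-sum {m} K _))) ⟩
    ∑[ a < m ] (K * ∑[ c < m ] (⟦ aH a c ⟧ * (nVert H a c * nVert H c a)))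
      ≡⟨ *-distribˡ-sum {m} K _ ⟨
    K * ∑[ a < m ] ∑[ c < m ] (⟦ aH a c ⟧ * (nVert H a c * nVert H c a))
      ≡⟨ cong (K *_) twice-Sz-H ⟨
    K * (2 * Sz H) ∎
    where
    open ≡-Reasoning
    K : ℕ
    K = (n * m ^ suc j) * (n * m ^ suc j)
    regroup : ∀ b n x y p → b * ((n * (x * p)) * (n * (y * p))) ≡ (n * p) * (n * p) * (b * (x * y))
    regroup = solve-∀

  twice-Sz-wreath : 2 * Sz W ≡ n * ((n * m ^ suc j) * (n * m ^ suc j) * (2 * Sz H) * m ^ suc j)
                              + m ^ n * (n * (suc j * (moveCount * moveCount)))
  twice-Sz-wreath = begin
    2 * Sz W
      ≡⟨ twice-Sz W adj-wreath-sym adj-wreath-irrefl ⟩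
    ∑[ y ∈ verts W ] ∑[ z ∈ verts W ] (⟦ adj W y z ⟧ * weight y z)
      ≡⟨ ∑-list-cong (verts W) per-vertex ⟩
    ∑[ y ∈ verts W ] (φ (lookup (proj₁ y) (proj₂ y)) + suc j * (moveCount * moveCount))
      ≡⟨ ∑-list-distrib-+ (verts W) _ _ ⟩
    ∑[ y ∈ verts W ] φ (lookup (proj₁ y) (proj₂ y)) + ∑[ y ∈ verts W ] (suc j * (moveCount * moveCount))
      ≡⟨ cong₂ _+_ layers moves ⟩
    n * ((n * m ^ suc j) * (n * m ^ suc j) * (2 * Sz H) * m ^ suc j) + m ^ n * (n * (suc j * (moveCount * moveCount))) ∎
    where
    open ≡-Reasoning
    φ : Fin m → ℕ
    φ a = ∑[ c < m ] (⟦ aH a c ⟧ * layerWeight a c)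
    per-vertex : ∀ y → ∑[ z ∈ verts W ] (⟦ adj W y z ⟧ * weight y z) ≡ φ (lookup (proj₁ y) (proj₂ y)) + suc j * (moveCount * moveCount)
    per-vertex (f , v) = begin
      ∑[ z ∈ verts W ] (⟦ adj W (f , v) z ⟧ * weight (f , v) z)
        ≡⟨ ∑-list-cong (verts W) (λ z → trans (cong (_* weight (f , v) z) (⟦adj⟧ z))
                                               (*-distribʳ-+ (weight (f , v) z) ⟦ layerAdj f v z ⟧ ⟦ moveAdj f v z ⟧)) ⟩
      ∑[ z ∈ verts W ] (⟦ layerAdj f v z ⟧ * weight (f , v) z + ⟦ moveAdj f v z ⟧ * weight (f , v) z)
        ≡⟨ ∑-list-distrib-+ (verts W) _ _ ⟩
      ∑[ z ∈ verts W ] (⟦ layerAdj f v z ⟧ * weight (f , v) z) + ∑[ z ∈ verts W ] (⟦ moveAdj f v z ⟧ * weight (f , v) z)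
        ≡⟨ cong₂ _+_ (layer-edges f v) (move-edges f v) ⟩
      φ (lookup f v) + suc j * (moveCount * moveCount) ∎
      where
      ⟦adj⟧ : ∀ z → ⟦ adj W (f , v) z ⟧ ≡ ⟦ layerAdj f v z ⟧ + ⟦ moveAdj f v z ⟧
      ⟦adj⟧ (f' , v') = ⟦∨-disjoint⟧ (does (v ≟ v')) _ _
    layers : ∑[ y ∈ verts W ] φ (lookup (proj₁ y) (proj₂ y)) ≡ n * ((n * m ^ suc j) * (n * m ^ suc j) * (2 * Sz H) * m ^ suc j)
    layers = begin
      ∑[ y ∈ verts W ] φ (lookup (proj₁ y) (proj₂ y))
        ≡⟨ ∑-cartesianProduct (allVecs n m) (allFin n) _ ⟩
      ∑[ f ∈ allVecs n m ] ∑[ v ∈ allFin n ] φ (lookup f v)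
        ≡⟨ ∑-list-cong (allVecs n m) (λ f → ∑-allFin n (λ v → φ (lookup f v))) ⟩
      ∑[ f ∈ allVecs n m ] ∑[ v < n ] φ (lookup f v)
        ≡⟨ ∑-list-sum-comm (allVecs n m) n (λ f v → φ (lookup f v)) ⟩
      ∑[ v < n ] ∑[ f ∈ allVecs n m ] φ (lookup f v)
        ≡⟨ sum-cong-≗ {n} (λ v → ∑-allVecs-coord m v φ) ⟩
      ∑[ v < n ] (sum φ * m ^ suc j)
        ≡⟨ ∑-const n (sum φ * m ^ suc j) ⟩
      n * (sum φ * m ^ suc j)
        ≡⟨ cong (λ t → n * (t * m ^ suc j)) layer-total ⟩
      n * ((n * m ^ suc j) * (n * m ^ suc j) * (2 * Sz H) * m ^ suc j) ∎
    C : ℕ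
    C = suc j * (moveCount * moveCount)
    moves : ∑[ y ∈ verts W ] C ≡ m ^ n * (n * C)
    moves = begin
      ∑[ y ∈ verts W ] (suc j * (moveCount * moveCount))
        ≡⟨ ∑-cartesianProduct (allVecs n m) (allFin n) _ ⟩
      ∑[ f ∈ allVecs n m ] ∑[ v ∈ allFin n ] (suc j * (moveCount * moveCount))
        ≡⟨ ∑-list-cong (allVecs n m) (λ _ → trans (∑-list-const (allFin n) C) (cong (_* C) (ListP.length-tabulate {n = n} (λ v → v)))) ⟩
      ∑[ f ∈ allVecs n m ] (n * (suc j * (moveCount * moveCount)))
        ≡⟨ trans (∑-list-const (allVecs n m) (n * C)) (cong (_* (n * C)) (length-allVecs n m)) ⟩
      m ^ n * (n * (suc j * (moveCount * moveCount))) ∎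

^-3n∸3 : ∀ j m → m ^ (3 * suc (suc j) ∸ 3) ≡ m ^ suc j * (m ^ suc j * m ^ suc j)
^-3n∸3 j m = begin
  m ^ (3 * suc (suc j) ∸ 3)                ≡⟨ cong (λ t → m ^ (t ∸ 3)) (split j) ⟩
  m ^ (3 + (suc j + (suc j + suc j)) ∸ 3)  ≡⟨ cong (m ^_) (m+n∸m≡n 3 (suc j + (suc j + suc j))) ⟩
  m ^ (suc j + (suc j + suc j))            ≡⟨ ^-distribˡ-+-* m (suc j) _ ⟩
  m ^ suc j * m ^ (suc j + suc j)          ≡⟨ cong (m ^ suc j *_) (^-distribˡ-+-* m (suc j) (suc j)) ⟩
  m ^ suc j * (m ^ suc j * m ^ suc j)      ∎
  where
  open ≡-Reasoning
  split : ∀ j → 3 * suc (suc j) ≡ 3 + (suc j + (suc j + suc j))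
  split = solve-∀

halve : ∀ s a b → 2 * s ≡ 2 * a + b → s ≡ a + b / 2
halve s a b 2s≡2a+b = begin
  s                    ≡⟨ m+[n∸m]≡n a≤s ⟨
  a + (s ∸ a)          ≡⟨ cong (a +_) (m*n/n≡m (s ∸ a) 2) ⟨
  a + (s ∸ a) * 2 / 2  ≡⟨ cong (λ t → a + t / 2) twice-difference ⟩
  a + b / 2            ∎
  where
  open ≡-Reasoning
  a≤s : a ≤ s
  a≤s = *-cancelˡ-≤ 2 (≤-trans (m≤m+n (2 * a) b) (≤-reflexive (sym 2s≡2a+b)))
  twice-difference : (s ∸ a) * 2 ≡ b
  twice-difference = begin
    (s ∸ a) * 2      ≡⟨ *-comm (s ∸ a) 2 ⟩
    2 * (s ∸ a)      ≡⟨ *-distribˡ-∸ 2 s a ⟩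
    2 * s ∸ 2 * a    ≡⟨ cong (_∸ 2 * a) 2s≡2a+b ⟩
    2 * a + b ∸ 2 * a ≡⟨ m+n∸m≡n (2 * a) b ⟩
    b                ∎

theorem6p16 : (n m : ℕ) → 2 ≤ n → (aH : Adj m) → IsSimple aH → IsConnected aH →
    Sz (wreath n m (completeAdj n) aH)
      ≡ n ^ 3 * m ^ (3 * n ∸ 3) * Sz (finGraph m aH)
        + (m ^ n * n * (n ∸ 1)
            * (m + m ^ (n ∸ 2) * (m * m + m * n + 2 ∸ (3 * m + n))) ^ 2) / 2
theorem6p16 n@(suc (suc j)) m (s≤s (s≤s z≤n)) aH simple connected =
  halve (Sz W) (n ^ 3 * m ^ (3 * n ∸ 3) * Sz H) (m ^ n * n * (n ∸ 1) * Y ^ 2) (begin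
    2 * Sz W
      ≡⟨ twice-Sz-wreath ⟩
    n * ((n * p) * (n * p) * (2 * Sz H) * p) + m ^ n * (n * (suc j * (moveCount * moveCount)))
      ≡⟨ cong (λ X → n * ((n * p) * (n * p) * (2 * Sz H) * p) + m ^ n * (n * (suc j * (X * X)))) moveCount-≡ ⟩
    n * ((n * p) * (n * p) * (2 * Sz H) * p) + m ^ n * (n * (suc j * (Y * Y)))
      ≡⟨ cong₂ _+_ (trans (layers n p (Sz H)) (cong (λ t → 2 * (n ^ 3 * t * Sz H)) (sym (^-3n∸3 j m))))
                   (moves (m ^ n) n (suc j) Y) ⟩
    2 * (n ^ 3 * m ^ (3 * n ∸ 3) * Sz H) + m ^ n * n * (n ∸ 1) * Y ^ 2 ∎)
  where
  open ≡-Reasoning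
  open Wreath {n} {m} aH connected using (H; W)
  open WreathCounts j aH connected using (moveCount; moveCount-≡)
  open WreathSzeged j aH simple connected using (twice-Sz-wreath)
  p Y : ℕ
  p = m ^ suc j
  Y = m + m ^ j * (m * m + m * n + 2 ∸ (3 * m + n))
  -- n ^ 3 and y ^ 2 unfold definitionally to the products written out here.
  layers : ∀ n p s → n * ((n * p) * (n * p) * (2 * s) * p) ≡ 2 * (n * (n * (n * 1)) * (p * (p * p)) * s)
  layers = solve-∀
  moves : ∀ a n s y → a * (n * (s * (y * y))) ≡ a * n * s * (y * (y * 1))
  moves = solve-∀
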